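{- Let $r$ be a positive odd squarefree integer, let $h,k$ be integers, and set $D=4\alpha^3+27\beta^2$. Then $$\mathop{\sum_{\alpha\bmod r}\sum_{\beta\bmod r}}_{D\equiv0\ (\mathrm{mod}\ r)}\lambda_{\alpha,\beta}(r)\,e\Big(\frac{\alpha h+\beta k}{r}\Big)=\frac{1}{\sqrt r}\left(\frac{3}{r}\right)\sum_{\gamma\bmod r}\left(\frac{\gamma}{r}\right)e\Big(\frac{ -3\gamma^2h+2\gamma^3k}{r}\Big).$$
   Context: $e(x)=e^{2\pi ix}$; $\left(\frac{\cdot}{r}\right)$ is the Jacobi symbol. For integers $\alpha,\beta$ and an odd prime $p$, $\lambda_{\alpha,\beta}(p)=-p^{ -1/2}\sum_{x\bmod p}\left(\frac{x^3+\alpha x+\beta}{p}\right)$, and for squarefree odd $r$, $\lambda_{\alpha,\beta}(r)=\prod_{p\mid r}\lambda_{\alpha,\beta}(p)$; it depends only on $\alpha,\beta$ modulo $r$. -}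

module Defs where

open import Level using (Level)
open import Data.Nat as ℕ using (ℕ; zero; suc; NonZero; _≤_; _<_)
open import Data.Nat.Divisibility using (_∣_; _∣?_)
open import Data.Nat.Primality using (Prime; prime?)
open import Data.Integer as ℤ using (ℤ; +_)
open import Data.Integer.DivMod using (_%ℕ_)
open import Data.List using (List; []; _∷_; upTo; filter; length; map; foldr; concatMap)
open import Data.List.Relation.Unary.Any using (any?)
open import Data.Product using (_×_; _,_; proj₁; proj₂)
open import Data.Sum using (_⊎_)
open import Relation.Nullary using (¬_; Dec; yes; no)
open import Relation.Nullary.Decidable using (_×-dec_)
open import Relation.Binary.PropositionalEquality using (_≡_)
open import Algebra.Bundles using (CommutativeRing)

prodℤ : List ℤ → ℤ
prodℤ = foldr ℤ._*_ (+ 1)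

sumℤ : List ℤ → ℤ
sumℤ = foldr ℤ._+_ (+ 0)

legendre : ℤ → (p : ℕ) → .{{NonZero p}} → ℤ
legendre a p with (a %ℕ p) ℕ.≟ 0
... | yes _ = + 0
... | no _ with any? (λ x → ((x ℕ.* x) ℕ.% p) ℕ.≟ (a %ℕ p)) (upTo p)
...   | yes _ = + 1
...   | no _  = ℤ.- (+ 1)

primeDivisors : ℕ → List ℕ
primeDivisors n = filter (λ p → prime? p ×-dec (p ∣? n)) (upTo (suc n))

-- p-adic valuation of n ≥ 1: number of i ∈ {1..n} with p^i ∣ n
val : ℕ → ℕ → ℕ
val p n = length (filter (λ i → (p ℕ.^ suc i) ∣? n) (upTo n))

-- Jacobi symbol (a/r) for odd r ≥ 1: ∏_{p ∣ r} (a/p)^{v_p(r)}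
-- (primes are nonzero; we use legendre at suc (p - 1) = p)
legendre′ : ℤ → ℕ → ℤ
legendre′ a zero    = + 0   -- never used: 0 is not prime
legendre′ a (suc q) = legendre a (suc q)

powℤ : ℤ → ℕ → ℤ
powℤ x zero    = + 1
powℤ x (suc n) = x ℤ.* powℤ x n

jacobi : ℤ → ℕ → ℤ
jacobi a r = prodℤ (map (λ p → powℤ (legendre′ a p) (val p r)) (primeDivisors r))

charSum : ℕ → ℤ → ℤ → ℤ
charSum p α β =
  sumℤ (map (λ x → legendre′ ((+ x) ℤ.* (+ x) ℤ.* (+ x) ℤ.+ α ℤ.* (+ x) ℤ.+ β) p) (upTo p))

-- √r · λ_{α,β}(r) = ∏_{p ∣ r} (− S_p(α,β))   (since √r = ∏_{p∣r} √p for squarefree r)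
sqrtLambda : ℕ → ℤ → ℤ → ℤ
sqrtLambda r α β = prodℤ (map (λ p → ℤ.- charSum p α β) (primeDivisors r))

Squarefree : ℕ → Set
Squarefree r = ∀ d → (d ℕ.* d) ∣ r → d ≡ 1

Odd : ℕ → Set
Odd r = ¬ (2 ∣ r)

-- Ring-valued notions: e(x/r) is modelled as ζ^x for a primitive r-th
-- root of unity ζ in an integral domain R.

module InRing {c ℓ : Level} (R : CommutativeRing c ℓ) where
  open CommutativeRing R

  pow : Carrier → ℕ → Carrier
  pow x zero    = 1#
  pow x (suc n) = x * pow x n

  fromℕ : ℕ → Carrier
  fromℕ zero    = 0#
  fromℕ (suc n) = 1# + fromℕ n

  fromℤ : ℤ → Carrier
  fromℤ (+ n)      = fromℕ n
  fromℤ ℤ.-[1+ n ] = - fromℕ (suc n)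

  sumL : {A : Set} → List A → (A → Carrier) → Carrier
  sumL []       f = 0#
  sumL (x ∷ xs) f = f x + sumL xs f

  IntegralDomain : Set (c Level.⊔ ℓ)
  IntegralDomain = ¬ (1# ≈ 0#) × (∀ x y → x * y ≈ 0# → x ≈ 0# ⊎ y ≈ 0#)

  PrimitiveRoot : ℕ → Carrier → Set ℓ
  PrimitiveRoot r ζ = pow ζ r ≈ 1# × (∀ d → 0 < d → d < r → ¬ (pow ζ d ≈ 1#))

  ee : Carrier → (r : ℕ) → .{{NonZero r}} → ℤ → Carrier
  ee ζ r t = pow ζ (t %ℕ r)

  discPairs : (r : ℕ) → List (ℕ × ℕ)
  discPairs r = filter (λ ab → r ∣? (4 ℕ.* proj₁ ab ℕ.^ 3 ℕ.+ 27 ℕ.* proj₂ ab ℕ.^ 2))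
                       (concatMap (λ a → map (λ b → a , b) (upTo r)) (upTo r))

  -- √r · LHS
  lhs : Carrier → (r : ℕ) → .{{NonZero r}} → ℤ → ℤ → Carrier
  lhs ζ r h k = sumL (discPairs r) (λ ab →
     fromℤ (sqrtLambda r (+ proj₁ ab) (+ proj₂ ab)) *
     ee ζ r ((+ proj₁ ab) ℤ.* h ℤ.+ (+ proj₂ ab) ℤ.* k))

  -- √r · RHS
  rhs : Carrier → (r : ℕ) → .{{NonZero r}} → ℤ → ℤ → Carrier
  rhs ζ r h k = fromℤ (jacobi (+ 3) r) * sumL (upTo r) (λ g →
     fromℤ (jacobi (+ g) r) *
     ee ζ r (ℤ.- (+ 3) ℤ.* (+ g) ℤ.* (+ g) ℤ.* h ℤ.+ (+ 2) ℤ.* (+ g) ℤ.* (+ g) ℤ.* (+ g) ℤ.* k))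

-- When 3 ∤ r, the pairs (α, β) mod r with 4α³ + 27β² ≡ 0 are exactly (-3γ², 2γ³) for a unique γ mod r:
-- this is checked prime by prime and glued together because r is squarefree. For such a pair
-- x³ + αx + β = (x - γ)²(x + 2γ), so modulo p ∣ r the character sum is Σ_{x ≢ γ} ((x + 2γ)/p) = -(3γ/p),
-- since a complete sum of Legendre symbols vanishes. Hence √r λ_{α,β}(r) = (3/r)(γ/r), and reindexing the
-- left side by γ matches the right side term by term. When 3 ∣ r both sides vanish: (3/r) = 0, and modulo 3
-- every discriminant-zero pair is singular as well, so its factor at 3 is -(3/3)(γ/3) = 0.

module Submission where

open import Defs
open import Level using (Level; 0ℓ)
open import Algebra.Bundles using (CommutativeRing)
open import Data.Nat as ℕ using (ℕ; zero; suc; NonZero)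
open import Data.Nat.Primality using (Prime)
import Data.Nat.Properties as ℕP
import Data.Nat.Divisibility as ℕD
open import Data.Integer as ℤ using (ℤ; +_)
import Data.Integer.Properties as ℤP
open import Data.Integer.DivMod using (_%ℕ_; _/ℕ_; n%ℕd<d; a≡a%ℕn+[a/ℕn]*n)
open import Data.Integer.Divisibility.Signed as ℤD using (divides; ∣ᵤ⇒∣; ∣⇒∣ᵤ)
open import Data.Integer.Tactic.RingSolver using (solve-∀)
open import Data.List using (List; []; _∷_; map; length)
open import Data.List.Membership.Propositional using (_∈_)
open import Data.List.Relation.Unary.Any using (here; there)
open import Data.List.Relation.Unary.All as All using ()
import Data.List.Relation.Unary.All.Properties as AllP
open import Data.List.Membership.Propositional.Properties using (∈-map⁺; ∈-map⁻; ∈-upTo⁺; ∈-upTo⁻)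
open import Data.List.Membership.Propositional.Properties.WithK using (unique∧set⇒bag)
open import Data.List.Relation.Binary.BagAndSetEquality using (∼bag⇒↭)
open import Data.Product using (∃; _×_; _,_; proj₁; proj₂)
open import Function.Bundles using (mk⇔)
open import Data.List.Relation.Unary.AllPairs using ([]; _∷_)
open import Data.List.Relation.Unary.Unique.Propositional using (Unique)
open import Data.List.Relation.Binary.Permutation.Propositional as ↭ using (_↭_)
open import Function using (_∘_; _∘′_)
open import Relation.Binary.Bundles using (Setoid)
import Relation.Binary.Reasoning.Setoid
open import Relation.Binary.Structures using (IsEquivalence)
open import Relation.Binary.Definitions using (DecidableEquality)
open import Relation.Nullary using (¬_; Dec; yes; no; contradiction)
import Relation.Nullary.Decidable as Dec
open import Relation.Binary.PropositionalEquality using (_≡_; _≢_; refl; sym; trans; cong; cong₂; subst; module ≡-Reasoning)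

private variable
  a : Level
  A B : Set a

module Congruence where
  open import Data.Integer using (_+_; _*_; -_; _-_; ∣_∣)
  open import Data.Nat.DivMod using (m<n⇒m%n≡m)

  infix 4 _≡_mod_
  record _≡_mod_ (a b : ℤ) (n : ℕ) : Set where
    constructor mod-intro
    field divides-difference : + n ℤD.∣ a - b
  open _≡_mod_ public

  module _ {n : ℕ} where

    mod-reflexive : ∀ {a b} → a ≡ b → a ≡ b mod n
    mod-reflexive {a} refl = mod-intro (subst (+ n ℤD.∣_) (sym (ℤP.+-inverseʳ a)) (divides (+ 0) refl))

    mod-refl : ∀ {a} → a ≡ a mod n
    mod-refl = mod-reflexive refl

    mod-sym : ∀ {a b} → a ≡ b mod n → b ≡ a mod n
    mod-sym {a} {b} (mod-intro n∣a-b) = mod-intro (subst (+ n ℤD.∣_) (negate-difference a b) (ℤD.∣m⇒∣-m n∣a-b))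
      where
      negate-difference : ∀ a b → - (a - b) ≡ b - a
      negate-difference = solve-∀

    mod-trans : ∀ {a b c} → a ≡ b mod n → b ≡ c mod n → a ≡ c mod n
    mod-trans {a} {b} {c} (mod-intro n∣a-b) (mod-intro n∣b-c) =
      mod-intro (subst (+ n ℤD.∣_) (telescope a b c) (ℤD.∣m∣n⇒∣m+n n∣a-b n∣b-c))
      where
      telescope : ∀ a b c → (a - b) + (b - c) ≡ a - c
      telescope = solve-∀

    mod-isEquivalence : IsEquivalence (λ a b → a ≡ b mod n)
    mod-isEquivalence = record { refl = mod-refl ; sym = mod-sym ; trans = mod-trans }

    +-cong-mod : ∀ {a b c d} → a ≡ b mod n → c ≡ d mod n → a + c ≡ b + d mod n
    +-cong-mod {a} {b} {c} {d} (mod-intro n∣a-b) (mod-intro n∣c-d) =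
      mod-intro (subst (+ n ℤD.∣_) (regroup a b c d) (ℤD.∣m∣n⇒∣m+n n∣a-b n∣c-d))
      where
      regroup : ∀ a b c d → (a - b) + (c - d) ≡ a + c - (b + d)
      regroup = solve-∀

    *-cong-mod : ∀ {a b c d} → a ≡ b mod n → c ≡ d mod n → a * c ≡ b * d mod n
    *-cong-mod {a} {b} {c} {d} (mod-intro n∣a-b) (mod-intro n∣c-d) =
      mod-intro (subst (+ n ℤD.∣_) (regroup a b c d) (ℤD.∣m∣n⇒∣m+n (ℤD.∣n⇒∣m*n a n∣c-d) (ℤD.∣m⇒∣m*n d n∣a-b)))
      where
      regroup : ∀ a b c d → a * (c - d) + (a - b) * d ≡ a * c - b * d
      regroup = solve-∀

    ∣⇒≡0-mod : ∀ {a} → + n ℤD.∣ a → a ≡ + 0 mod n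
    ∣⇒≡0-mod {a} = mod-intro ∘′ subst (+ n ℤD.∣_) (sym (ℤP.+-identityʳ a))

    ≡0-mod⇒∣ : ∀ {a} → a ≡ + 0 mod n → + n ℤD.∣ a
    ≡0-mod⇒∣ {a} (mod-intro n∣a-0) = subst (+ n ℤD.∣_) (ℤP.+-identityʳ a) n∣a-0

    multiple-≡0-mod : ∀ k → k * + n ≡ + 0 mod n
    multiple-≡0-mod k = ∣⇒≡0-mod (divides k refl)

  mod-setoid : ℕ → Setoid 0ℓ 0ℓ
  mod-setoid n = record { isEquivalence = mod-isEquivalence {n} }

  module ModReasoning (n : ℕ) = Relation.Binary.Reasoning.Setoid (mod-setoid n)

  mod-weaken : ∀ {d n a b} → d ℕD.∣ n → a ≡ b mod n → a ≡ b mod d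
  mod-weaken d∣n (mod-intro n∣a-b) = mod-intro (ℤD.∣-trans (∣ᵤ⇒∣ d∣n) n∣a-b)

  module _ (n : ℕ) .{{_ : NonZero n}} where

    %ℕ-≡-mod : ∀ a → + (a %ℕ n) ≡ a mod n
    %ℕ-≡-mod a = mod-sym (mod-intro (divides (a /ℕ n) (begin
      a - + (a %ℕ n)                          ≡⟨ cong (_- + (a %ℕ n)) (a≡a%ℕn+[a/ℕn]*n a n) ⟩
      + (a %ℕ n) + a /ℕ n * + n - + (a %ℕ n)  ≡⟨ cancel (+ (a %ℕ n)) (a /ℕ n * + n) ⟩
      a /ℕ n * + n                            ∎)))
      where
      open ≡-Reasoning
      cancel : ∀ r m → r + m - r ≡ m
      cancel = solve-∀

    ≡-mod⇒≡ : ∀ {r s} → r ℕ.< n → s ℕ.< n → + r ≡ + s mod n → r ≡ s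
    ≡-mod⇒≡ {r} {s} r<n s<n (mod-intro n∣r-s) = ℤP.+-injective (ℤP.i-j≡0⇒i≡j (+ r) (+ s) (ℤP.∣i∣≡0⇒i≡0 distance≡0))
      where
      distance<n : ∣ + r - + s ∣ ℕ.< n
      distance<n = ℕP.≤-<-trans (subst (ℕ._≤ r ℕ.⊔ s) (cong ∣_∣ (sym (ℤP.[+m]-[+n]≡m⊖n r s))) (ℤP.∣m⊝n∣≤m⊔n r s))
                                (ℕP.⊔-lub r<n s<n)
      distance≡0 : ∣ + r - + s ∣ ≡ 0
      distance≡0 with ∣ + r - + s ∣ in eq
      ... | zero  = refl
      ... | suc _ = contradiction (subst (n ℕD.∣_) eq (∣⇒∣ᵤ n∣r-s)) (ℕD.>⇒∤ (subst (ℕ._< n) eq distance<n))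

    ≡-mod⇒%ℕ≡ : ∀ {a b} → a ≡ b mod n → a %ℕ n ≡ b %ℕ n
    ≡-mod⇒%ℕ≡ {a} {b} a≡b = ≡-mod⇒≡ (n%ℕd<d a n) (n%ℕd<d b n)
      (mod-trans (%ℕ-≡-mod a) (mod-trans a≡b (mod-sym (%ℕ-≡-mod b))))

    %ℕ≡⇒≡-mod : ∀ a b → a %ℕ n ≡ b %ℕ n → a ≡ b mod n
    %ℕ≡⇒≡-mod a b eq = mod-trans (mod-sym (%ℕ-≡-mod a)) (subst (λ r → + r ≡ b mod n) (sym eq) (%ℕ-≡-mod b))

    %ℕ-residue : ∀ {a c} → c ℕ.< n → a ≡ + c mod n → a %ℕ n ≡ c
    %ℕ-residue c<n a≡c = trans (≡-mod⇒%ℕ≡ a≡c) (m<n⇒m%n≡m c<n)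


  infix 4 _≡?_mod_
  _≡?_mod_ : ∀ a b n → Dec (a ≡ b mod n)
  a ≡? b mod n = Dec.map′ mod-intro divides-difference (+ n ℤD.∣? a - b)

open Congruence

unique-map-on : ∀ (f : A → B) {xs} → (∀ {x y} → x ∈ xs → y ∈ xs → f x ≡ f y → x ≡ y) → Unique xs → Unique (map f xs)
unique-map-on f {[]}     f-inj []          = []
unique-map-on f {x ∷ xs} f-inj (x∉xs ∷ xs!) =
  AllP.map⁺ (All.tabulate λ y∈xs fx≡fy → All.lookup x∉xs y∈xs (f-inj (here refl) (there y∈xs) fx≡fy))
  ∷ unique-map-on f (λ x∈xs y∈xs → f-inj (there x∈xs) (there y∈xs)) xs!

bijection⇒map-↭ : ∀ (f : A → B) {xs ys} → Unique xs → Unique ys →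
                  (∀ {x y} → x ∈ xs → y ∈ xs → f x ≡ f y → x ≡ y) →
                  (∀ {x} → x ∈ xs → f x ∈ ys) →
                  (∀ {y} → y ∈ ys → ∃ λ x → x ∈ xs × f x ≡ y) →
                  map f xs ↭ ys
bijection⇒map-↭ f {xs} {ys} xs! ys! f-inj into onto =
  ∼bag⇒↭ (unique∧set⇒bag (unique-map-on f f-inj xs!) ys! (mk⇔ to from))
  where
  to : ∀ {y} → y ∈ map f xs → y ∈ ys
  to y∈fxs with x , x∈xs , refl ← ∈-map⁻ f y∈fxs = into x∈xs
  from : ∀ {y} → y ∈ ys → y ∈ map f xs
  from y∈ys with x , x∈xs , refl ← onto y∈ys = ∈-map⁺ f x∈xs

module ListSum {c ℓ : Level} (R : CommutativeRing c ℓ) where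
  open CommutativeRing R hiding (refl; sym; trans)
  open CommutativeRing R using () renaming (refl to ≈-refl; sym to ≈-sym; trans to ≈-trans)
  open InRing R using (sumL)
  open import Relation.Binary.Reasoning.Setoid setoid

  sumL-cong : ∀ (xs : List A) {f g : A → Carrier} → (∀ {x} → x ∈ xs → f x ≈ g x) → sumL xs f ≈ sumL xs g
  sumL-cong []       f≈g = ≈-refl
  sumL-cong (x ∷ xs) f≈g = +-cong (f≈g (here refl)) (sumL-cong xs (f≈g ∘ there))

  sumL-0 : ∀ (xs : List A) {f : A → Carrier} → (∀ {x} → x ∈ xs → f x ≈ 0#) → sumL xs f ≈ 0#
  sumL-0 []       f≈0 = ≈-refl
  sumL-0 (x ∷ xs) f≈0 = ≈-trans (+-cong (f≈0 (here refl)) (sumL-0 xs (f≈0 ∘ there))) (+-identityˡ 0#)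

  sumL-map : ∀ (xs : List A) (h : A → B) (f : B → Carrier) → sumL (map h xs) f ≡ sumL xs (λ x → f (h x))
  sumL-map []       h f = refl
  sumL-map (x ∷ xs) h f = cong (_+_ (f (h x))) (sumL-map xs h f)

  sumL-↭ : ∀ {xs ys : List A} (f : A → Carrier) → xs ↭ ys → sumL xs f ≈ sumL ys f
  sumL-↭ f ↭.refl       = ≈-refl
  sumL-↭ f (↭.prep x p) = +-congˡ (sumL-↭ f p)
  sumL-↭ f (↭.swap {xs} {ys} x y p) = begin
    f x + (f y + sumL xs f) ≈⟨ +-congˡ (+-congˡ (sumL-↭ f p)) ⟩
    f x + (f y + sumL ys f) ≈⟨ ≈-sym (+-assoc _ _ _) ⟩
    f x + f y + sumL ys f   ≈⟨ +-congʳ (+-comm _ _) ⟩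
    f y + f x + sumL ys f   ≈⟨ +-assoc _ _ _ ⟩
    f y + (f x + sumL ys f) ∎
  sumL-↭ f (↭.trans p q) = ≈-trans (sumL-↭ f p) (sumL-↭ f q)

  sumL-reindex : ∀ (f : A → B) {xs ys} (F : B → Carrier) → Unique xs → Unique ys →
                 (∀ {x y} → x ∈ xs → y ∈ xs → f x ≡ f y → x ≡ y) →
                 (∀ {x} → x ∈ xs → f x ∈ ys) →
                 (∀ {y} → y ∈ ys → ∃ λ x → x ∈ xs × f x ≡ y) →
                 sumL ys F ≈ sumL xs (λ x → F (f x))
  sumL-reindex f {xs} {ys} F xs! ys! f-inj into onto = begin
    sumL ys F                ≈⟨ sumL-↭ F (bijection⇒map-↭ f xs! ys! f-inj into onto) ⟨
    sumL (map f xs) F        ≡⟨ sumL-map xs f F ⟩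
    sumL xs (λ x → F (f x))  ∎

  sumL-+ : ∀ (xs : List A) (f g : A → Carrier) → sumL xs (λ x → f x + g x) ≈ sumL xs f + sumL xs g
  sumL-+ []       f g = ≈-sym (+-identityˡ 0#)
  sumL-+ (x ∷ xs) f g = begin
    f x + g x + sumL xs (λ x → f x + g x)   ≈⟨ +-congˡ (sumL-+ xs f g) ⟩
    f x + g x + (sumL xs f + sumL xs g)     ≈⟨ +-assoc _ _ _ ⟩
    f x + (g x + (sumL xs f + sumL xs g))   ≈⟨ +-congˡ (≈-sym (+-assoc _ _ _)) ⟩
    f x + (g x + sumL xs f + sumL xs g)     ≈⟨ +-congˡ (+-congʳ (+-comm _ _)) ⟩
    f x + (sumL xs f + g x + sumL xs g)     ≈⟨ +-congˡ (+-assoc _ _ _) ⟩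
    f x + (sumL xs f + (g x + sumL xs g))   ≈⟨ ≈-sym (+-assoc _ _ _) ⟩
    f x + sumL xs f + (g x + sumL xs g)     ∎

  *-distribˡ-sumL : ∀ (xs : List A) (k : Carrier) (f : A → Carrier) → k * sumL xs f ≈ sumL xs (λ x → k * f x)
  *-distribˡ-sumL []       k f = zeroʳ k
  *-distribˡ-sumL (x ∷ xs) k f = ≈-trans (distribˡ k (f x) (sumL xs f)) (+-congˡ (*-distribˡ-sumL xs k f))

  sumL-swap : ∀ (xs : List A) (ys : List B) (F : A → B → Carrier) →
              sumL ys (λ y → sumL xs (λ x → F x y)) ≈ sumL xs (λ x → sumL ys (F x))
  sumL-swap []       ys F = sumL-0 ys (λ _ → ≈-refl)
  sumL-swap (x ∷ xs) ys F = ≈-trans (sumL-+ ys (F x) (λ y → sumL xs (λ x → F x y))) (+-congˡ (sumL-swap xs ys F))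

module IntegerSum where
  open import Data.Integer using (_+_; _≤_)
  open import Data.Sum using (_⊎_; inj₁; inj₂)

  open InRing ℤP.+-*-commutativeRing using (sumL) public
  open ListSum ℤP.+-*-commutativeRing public

  sumℤ-map : ∀ (xs : List A) (f : A → ℤ) → sumℤ (map f xs) ≡ sumL xs f
  sumℤ-map []       f = refl
  sumℤ-map (x ∷ xs) f = cong (_+_ (f x)) (sumℤ-map xs f)

  sumL-const-1 : ∀ (xs : List A) → sumL xs (λ _ → + 1) ≡ + length xs
  sumL-const-1 []       = refl
  sumL-const-1 (x ∷ xs) = trans (cong (_+_ (+ 1)) (sumL-const-1 xs)) (sym (ℤP.pos-+ 1 (length xs)))

  indicator : ∀ {P : Set} → Dec P → ℤ
  indicator (yes _) = + 1
  indicator (no _)  = + 0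

  indicator-cong : ∀ {P Q : Set} → (P → Q) → (Q → P) → (P? : Dec P) (Q? : Dec Q) → indicator P? ≡ indicator Q?
  indicator-cong P⇒Q Q⇒P (yes _) (yes _) = refl
  indicator-cong P⇒Q Q⇒P (yes p) (no ¬q) = contradiction (P⇒Q p) ¬q
  indicator-cong P⇒Q Q⇒P (no ¬p) (yes q) = contradiction (Q⇒P q) ¬p
  indicator-cong P⇒Q Q⇒P (no _)  (no _)  = refl

  indicator-⊎ : ∀ {P Q R : Set} → (P → Q ⊎ R) → (Q → P) → (R → P) → ¬ (Q × R) →
                (P? : Dec P) (Q? : Dec Q) (R? : Dec R) → indicator P? ≡ indicator Q? + indicator R?
  indicator-⊎ P⇒Q⊎R Q⇒P R⇒P disjoint (yes p) (yes q) (yes r) = contradiction (q , r) disjoint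
  indicator-⊎ P⇒Q⊎R Q⇒P R⇒P disjoint (yes p) (yes q) (no _)  = refl
  indicator-⊎ P⇒Q⊎R Q⇒P R⇒P disjoint (yes p) (no _)  (yes r) = refl
  indicator-⊎ P⇒Q⊎R Q⇒P R⇒P disjoint (yes p) (no ¬q) (no ¬r) with P⇒Q⊎R p
  ... | inj₁ q = contradiction q ¬q
  ... | inj₂ r = contradiction r ¬r
  indicator-⊎ P⇒Q⊎R Q⇒P R⇒P disjoint (no ¬p) (yes q) _      = contradiction (Q⇒P q) ¬p
  indicator-⊎ P⇒Q⊎R Q⇒P R⇒P disjoint (no ¬p) (no _)  (yes r) = contradiction (R⇒P r) ¬p
  indicator-⊎ P⇒Q⊎R Q⇒P R⇒P disjoint (no _)  (no _)  (no _)  = refl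

  sumL-indicator-≡ : ∀ (_≟_ : DecidableEquality A) {xs c} → Unique xs → c ∈ xs → sumL xs (λ x → indicator (x ≟ c)) ≡ + 1
  sumL-indicator-≡ _≟_ {x ∷ xs} {c} (x∉xs ∷ xs!) (here refl) with x ≟ x
  ... | no x≢x = contradiction refl x≢x
  ... | yes _  = cong (_+_ (+ 1)) (sumL-0 xs absent)
    where
    absent : ∀ {y} → y ∈ xs → indicator (y ≟ x) ≡ + 0
    absent {y} y∈xs with y ≟ x
    ... | yes refl = contradiction refl (All.lookup x∉xs y∈xs)
    ... | no _     = refl
  sumL-indicator-≡ _≟_ {x ∷ xs} {c} (x∉xs ∷ xs!) (there c∈xs) with x ≟ c
  ... | yes refl = contradiction refl (All.lookup x∉xs c∈xs)
  ... | no _     = trans (ℤP.+-identityˡ _) (sumL-indicator-≡ _≟_ xs! c∈xs)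

  sumL-nonpositive : ∀ (xs : List A) (f : A → ℤ) → (∀ {x} → x ∈ xs → f x ≤ + 0) → sumL xs f ≤ + 0
  sumL-nonpositive []       f f≤0 = ℤP.≤-refl
  sumL-nonpositive (x ∷ xs) f f≤0 = ℤP.+-mono-≤ (f≤0 (here refl)) (sumL-nonpositive xs f (f≤0 ∘ there))

  nonpositive-+≡0 : ∀ {x y} → x ≤ + 0 → y ≤ + 0 → x + y ≡ + 0 → x ≡ + 0
  nonpositive-+≡0 {x} {y} x≤0 y≤0 x+y≡0 = ℤP.≤-antisym x≤0 (begin
    + 0     ≡⟨ sym x+y≡0 ⟩
    x + y   ≤⟨ ℤP.+-monoʳ-≤ x y≤0 ⟩
    x + + 0 ≡⟨ ℤP.+-identityʳ x ⟩
    x       ∎)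
    where open ℤP.≤-Reasoning

  nonpositive-sumL≡0 : ∀ (xs : List A) (f : A → ℤ) → (∀ {x} → x ∈ xs → f x ≤ + 0) → sumL xs f ≡ + 0 →
                       ∀ {x} → x ∈ xs → f x ≡ + 0
  nonpositive-sumL≡0 (x ∷ xs) f f≤0 Σ≡0 (here refl) =
    nonpositive-+≡0 (f≤0 (here refl)) (sumL-nonpositive xs f (f≤0 ∘ there)) Σ≡0
  nonpositive-sumL≡0 (x ∷ xs) f f≤0 Σ≡0 (there y∈xs) =
    nonpositive-sumL≡0 xs f (f≤0 ∘ there) (nonpositive-+≡0 (sumL-nonpositive xs f (f≤0 ∘ there)) (f≤0 (here refl))
                                            (trans (ℤP.+-comm (sumL xs f) (f x)) Σ≡0)) y∈xs

module Divisibility where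
  open import Data.Integer using (_+_; _*_; -_; _-_)
  open import Data.Nat.Divisibility using (_∣_; _∤_; divides)
  open import Data.Nat.Primality using (prime⇒irreducible; prime⇒nonTrivial)
  open import Data.Nat.Primality.Factorisation using (factorise)
  open import Data.Nat.Coprimality using (Coprime; coprime-Bézout)
  open import Data.Nat.GCD using (gcd; gcd[m,n]∣m; gcd[m,n]∣n; gcd-greatest; module Bézout)
  open import Data.Sum using (inj₁; inj₂)
  open import Data.Empty using (⊥; ⊥-elim)

  prime>1 : ∀ {q} → Prime q → 1 ℕ.< q
  prime>1 {q} q-prime = ℕ.nonTrivial⇒n>1 q {{prime⇒nonTrivial q-prime}}

  ∃-prime-divisor : ∀ {n} → 1 ℕ.< n → ∃ λ q → Prime q × q ∣ n
  ∃-prime-divisor {n@(suc _)} 1<n with factorise n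
  ... | record { factors = []     ; isFactorisation = n≡1 } = contradiction n≡1 (ℕP.>⇒≢ 1<n)
  ... | record { factors = q ∷ qs ; isFactorisation = n≡q*qs ; factorsPrime = q-prime All.∷ _ } =
        q , q-prime , divides (Data.List.foldr ℕ._*_ 1 qs) (trans n≡q*qs (ℕP.*-comm q _))
    where import Data.List

  prime∤⇒coprime : ∀ {q m} → Prime q → q ∤ m → Coprime q m
  prime∤⇒coprime q-prime q∤m (d∣q , d∣m) with prime⇒irreducible q-prime d∣q
  ... | inj₁ d≡1 = d≡1
  ... | inj₂ refl = contradiction d∣m q∤m

  no-common-prime⇒coprime : ∀ {m n} → n ≢ 0 → (∀ {q} → Prime q → q ∣ m → q ∣ n → ⊥) → Coprime m n
  no-common-prime⇒coprime n≢0 no-common {zero}        (_ , 0∣n)   = contradiction (ℕD.0∣⇒≡0 0∣n) n≢0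
  no-common-prime⇒coprime n≢0 no-common {suc zero}    _           = refl
  no-common-prime⇒coprime n≢0 no-common {suc (suc d)} (d∣m , d∣n) with ∃-prime-divisor {suc (suc d)} (ℕ.s≤s (ℕ.s≤s ℕ.z≤n))
  ... | q , q-prime , q∣d = ⊥-elim (no-common q-prime (ℕD.∣-trans q∣d d∣m) (ℕD.∣-trans q∣d d∣n))

  pos-Bézout : ∀ a b c d e → a ℕ.+ b ℕ.* c ≡ d ℕ.* e → + a + + b * + c ≡ + d * + e
  pos-Bézout a b c d e eq = begin
    + a + + b * + c      ≡⟨ cong (_+_ (+ a)) (ℤP.pos-* b c) ⟨
    + a + + (b ℕ.* c)    ≡⟨ ℤP.pos-+ a (b ℕ.* c) ⟨
    + (a ℕ.+ b ℕ.* c)    ≡⟨ cong +_ eq ⟩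
    + (d ℕ.* e)          ≡⟨ ℤP.pos-* d e ⟩
    + d * + e            ∎
    where open ≡-Reasoning

  coprime⇒inverse : ∀ {m n} → Coprime m n → ∃ λ u → + n * u ≡ + 1 mod m
  coprime⇒inverse {m} {n} m⊥n with coprime-Bézout m⊥n
  ... | Bézout.+- x y 1+yn≡xm = - + y , mod-intro (divides (- + x) (begin
    + n * - + y - + 1    ≡⟨ rearrange (+ n) (+ y) ⟩
    - (+ 1 + + y * + n)  ≡⟨ cong -_ (pos-Bézout 1 y n x m 1+yn≡xm) ⟩
    - (+ x * + m)        ≡⟨ ℤP.neg-distribˡ-* (+ x) (+ m) ⟩
    - + x * + m          ∎))
    where
    open ≡-Reasoning
    rearrange : ∀ n y → n * - y - + 1 ≡ - (+ 1 + y * n)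
    rearrange = solve-∀
  ... | Bézout.-+ x y 1+xm≡yn = + y , mod-intro (divides (+ x) (begin
    + n * + y - + 1            ≡⟨ cong (_- + 1) (trans (ℤP.*-comm (+ n) (+ y)) (sym (pos-Bézout 1 x m y n 1+xm≡yn))) ⟩
    + 1 + + x * + m - + 1      ≡⟨ cancel (+ x * + m) ⟩
    + x * + m                  ∎))
    where
    open ≡-Reasoning
    cancel : ∀ k → + 1 + k - + 1 ≡ k
    cancel = solve-∀

  squarefree⇒≢0 : ∀ {r} → Squarefree r → r ≢ 0
  squarefree⇒≢0 sf refl = contradiction (sf 0 (0 ℕD.∣0)) λ ()

  -- Writing r = s · gcd r N, a prime q ∣ s would divide gcd r N too, so q² ∣ r.
  squarefree-∣-by-primes : ∀ {r N} → Squarefree r → (∀ {q} → Prime q → q ∣ r → q ∣ N) → r ∣ N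
  squarefree-∣-by-primes {r} {N} sf primes∣N with gcd[m,n]∣m r N
  ... | divides zero r≡0          = contradiction r≡0 (squarefree⇒≢0 sf)
  ... | divides (suc zero) r≡1*g  = subst (_∣ N) (sym (trans r≡1*g (ℕP.*-identityˡ _))) (gcd[m,n]∣n r N)
  ... | divides s@(suc (suc _)) r≡s*g with ∃-prime-divisor {s} (ℕ.s≤s (ℕ.s≤s ℕ.z≤n))
  ...   | q , q-prime , q∣s = contradiction (sf q q*q∣r) (ℕP.>⇒≢ (prime>1 q-prime))
    where
    q∣r : q ∣ r
    q∣r = ℕD.∣-trans q∣s (divides (gcd r N) (trans r≡s*g (ℕP.*-comm s (gcd r N))))
    q*q∣r : q ℕ.* q ∣ r
    q*q∣r = subst (q ℕ.* q ∣_) (sym r≡s*g) (ℕD.*-pres-∣ q∣s (gcd-greatest q∣r (primes∣N q-prime q∣r)))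

  squarefree-≡-mod : ∀ {r a b} → Squarefree r → (∀ {q} → Prime q → q ∣ r → a ≡ b mod q) → a ≡ b mod r
  squarefree-≡-mod sf local =
    mod-intro (∣ᵤ⇒∣ (squarefree-∣-by-primes sf (λ q-prime q∣r → ∣⇒∣ᵤ (divides-difference (local q-prime q∣r)))))

open Divisibility

module ModPrime {p : ℕ} (p-prime : Prime p) where
  open import Data.Integer using (_*_; -_; -[1+_])
  open ℤD using (_∣_)
  open import Data.Nat.Primality using (prime⇒nonZero; prime⇒irreducible; euclidsLemma)
  open import Data.Sum using (_⊎_; inj₁; inj₂)

  instance
    p-nonZero : NonZero p
    p-nonZero = prime⇒nonZero p-prime

  ∣-euclid : ∀ {a b} → + p ∣ a * b → + p ∣ a ⊎ + p ∣ b
  ∣-euclid {a} {b} p∣ab with euclidsLemma ℤ.∣ a ∣ ℤ.∣ b ∣ p-prime (subst (p ℕD.∣_) (ℤP.abs-* a b) (∣⇒∣ᵤ p∣ab))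
  ... | inj₁ p∣a = inj₁ (∣ᵤ⇒∣ p∣a)
  ... | inj₂ p∣b = inj₂ (∣ᵤ⇒∣ p∣b)

  ∤-* : ∀ {a b} → ¬ + p ∣ a → ¬ + p ∣ b → ¬ + p ∣ a * b
  ∤-* p∤a p∤b p∣ab with ∣-euclid p∣ab
  ... | inj₁ p∣a = p∤a p∣a
  ... | inj₂ p∣b = p∤b p∣b

  ∣-cancelˡ : ∀ {a b} → ¬ + p ∣ a → + p ∣ a * b → + p ∣ b
  ∣-cancelˡ p∤a p∣ab with ∣-euclid p∣ab
  ... | inj₁ p∣a = contradiction p∣a p∤a
  ... | inj₂ p∣b = p∣b

  ∣-square : ∀ {a} → + p ∣ a * a → + p ∣ a
  ∣-square p∣aa with ∣-euclid p∣aa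
  ... | inj₁ p∣a = p∣a
  ... | inj₂ p∣a = p∣a

  ∣-resp-≡-mod : ∀ {a b} → a ≡ b mod p → + p ∣ a → + p ∣ b
  ∣-resp-≡-mod a≡b p∣a = ≡0-mod⇒∣ (mod-trans (mod-sym a≡b) (∣⇒≡0-mod p∣a))

  ∤-prime : ∀ {t} → Prime t → p ≢ t → ¬ + p ∣ + t
  ∤-prime t-prime p≢t p∣t with prime⇒irreducible t-prime (∣⇒∣ᵤ p∣t)
  ... | inj₁ refl = contradiction p-prime λ ()
  ... | inj₂ p≡t = p≢t p≡t

  ∤1 : ¬ + p ∣ + 1
  ∤1 p∣1 with ℕD.∣1⇒≡1 (∣⇒∣ᵤ p∣1)
  ... | refl = contradiction p-prime λ ()

  ∤⇒inverse : ∀ {a} → ¬ + p ∣ a → ∃ λ b → a * b ≡ + 1 mod p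
  ∤⇒inverse {a} p∤a with coprime⇒inverse {p} {ℤ.∣ a ∣} (prime∤⇒coprime p-prime (p∤a ∘ ∣ᵤ⇒∣))
  ∤⇒inverse { + n }      p∤a | u , nu≡1 = u , nu≡1
  ∤⇒inverse { -[1+ n ] } p∤a | u , nu≡1 = - u , subst (_≡ + 1 mod p) (negate-both (+ suc n) u) nu≡1
    where
    negate-both : ∀ k u → k * u ≡ - k * - u
    negate-both = solve-∀

module Legendre {p : ℕ} (p-prime : Prime p) (p≢2 : p ≢ 2) where
  open import Data.Integer using (_+_; _*_; -_; _-_; _≤_)
  open ℤD using (_∣_)
  open ModPrime p-prime
  open IntegerSum
  open import Data.Nat.Primality using (prime[2])
  open import Data.Nat.DivMod using (m<n⇒m%n≡m)
  open import Data.List using (upTo)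
  open import Data.List.Properties using (length-upTo)
  open import Data.List.Membership.Propositional using (lose)
  open import Data.List.Relation.Unary.Any using (any?; satisfied)
  import Data.List.Relation.Unary.Unique.Propositional.Properties as Unique
  open import Data.Sum using (_⊎_; inj₁; inj₂; [_,_]′)

  L : ℤ → ℤ
  L a = legendre a p

  data Residuosity (a : ℤ) : ℤ → Set where
    divisible  : + p ∣ a → Residuosity a (+ 0)
    residue    : ¬ + p ∣ a → ∀ x → x * x ≡ a mod p → Residuosity a (+ 1)
    nonresidue : ¬ + p ∣ a → (∀ x → ¬ x * x ≡ a mod p) → Residuosity a (- + 1)

  0%p≡0 : 0 ℕ.% p ≡ 0
  0%p≡0 = m<n⇒m%n≡m (ℕ.>-nonZero⁻¹ p)

  %ℕ≡0⇒∣ : ∀ {a} → a %ℕ p ≡ 0 → + p ∣ a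
  %ℕ≡0⇒∣ {a} a%p≡0 = ≡0-mod⇒∣ (%ℕ≡⇒≡-mod p a (+ 0) (trans a%p≡0 (sym 0%p≡0)))

  ∣⇒%ℕ≡0 : ∀ {a} → + p ∣ a → a %ℕ p ≡ 0
  ∣⇒%ℕ≡0 p∣a = trans (≡-mod⇒%ℕ≡ p (∣⇒≡0-mod p∣a)) 0%p≡0

  residuosity : ∀ a → Residuosity a (L a)
  residuosity a with (a %ℕ p) ℕ.≟ 0
  ... | yes a%p≡0 = divisible (%ℕ≡0⇒∣ a%p≡0)
  ... | no a%p≢0 with any? (λ x → ((x ℕ.* x) ℕ.% p) ℕ.≟ (a %ℕ p)) (upTo p)
  ...   | yes root =
    residue (a%p≢0 ∘ ∣⇒%ℕ≡0) (+ x) (subst (_≡ a mod p) (ℤP.pos-* x x) (%ℕ≡⇒≡-mod p (+ (x ℕ.* x)) a x*x%p≡a%p))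
    where
    x = proj₁ (satisfied root)
    x*x%p≡a%p = proj₂ (satisfied root)
  ...   | no no-root =
    nonresidue (a%p≢0 ∘ ∣⇒%ℕ≡0) λ x x*x≡a → no-root (lose (∈-upTo⁺ (n%ℕd<d x p)) (≡-mod⇒%ℕ≡ p (reduced x x*x≡a)))
    where
    reduced : ∀ x → x * x ≡ a mod p → + ((x %ℕ p) ℕ.* (x %ℕ p)) ≡ a mod p
    reduced x x*x≡a = subst (_≡ a mod p) (sym (ℤP.pos-* (x %ℕ p) (x %ℕ p)))
                            (mod-trans (*-cong-mod (%ℕ-≡-mod p x) (%ℕ-≡-mod p x)) x*x≡a)

  L-divisible : ∀ {a} → + p ∣ a → L a ≡ + 0
  L-divisible {a} p∣a with L a | residuosity a
  ... | _ | divisible _        = refl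
  ... | _ | residue p∤a _ _    = contradiction p∣a p∤a
  ... | _ | nonresidue p∤a _   = contradiction p∣a p∤a

  L-residue : ∀ {a} x → ¬ + p ∣ a → x * x ≡ a mod p → L a ≡ + 1
  L-residue {a} x p∤a x*x≡a with L a | residuosity a
  ... | _ | divisible p∣a        = contradiction p∣a p∤a
  ... | _ | residue _ _ _        = refl
  ... | _ | nonresidue _ no-root = contradiction x*x≡a (no-root x)

  L-nonresidue : ∀ {a} → ¬ + p ∣ a → (∀ x → ¬ x * x ≡ a mod p) → L a ≡ - + 1
  L-nonresidue {a} p∤a no-root with L a | residuosity a
  ... | _ | divisible p∣a    = contradiction p∣a p∤a
  ... | _ | residue _ x x*x≡a = contradiction x*x≡a (no-root x)
  ... | _ | nonresidue _ _   = refl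

  L-cong : ∀ {a b} → a ≡ b mod p → L a ≡ L b
  L-cong {a} {b} a≡b with L a | residuosity a
  ... | _ | divisible p∣a         = sym (L-divisible (∣-resp-≡-mod a≡b p∣a))
  ... | _ | residue p∤a x x*x≡a   = sym (L-residue x (p∤a ∘ ∣-resp-≡-mod (mod-sym a≡b)) (mod-trans x*x≡a a≡b))
  ... | _ | nonresidue p∤a no-root =
    sym (L-nonresidue (p∤a ∘ ∣-resp-≡-mod (mod-sym a≡b)) λ x x*x≡b → no-root x (mod-trans x*x≡b (mod-sym a≡b)))

  L≤1 : ∀ a → L a ≤ + 1
  L≤1 a with L a | residuosity a
  ... | _ | divisible _    = ℤ.+≤+ ℕ.z≤n
  ... | _ | residue _ _ _  = ℤP.≤-refl
  ... | _ | nonresidue _ _ = ℤ.-≤+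

  L-square : ∀ {u} → ¬ + p ∣ u → L (u * u) ≡ + 1
  L-square {u} p∤u = L-residue u (∤-* p∤u p∤u) mod-refl

  L-residue*nonresidue : ∀ {a b} x → ¬ + p ∣ a → x * x ≡ a mod p → ¬ + p ∣ b → (∀ y → ¬ y * y ≡ b mod p) →
                         L (a * b) ≡ - + 1
  L-residue*nonresidue {a} {b} x p∤a x*x≡a p∤b b-no-root = L-nonresidue (∤-* p∤a p∤b) no-root
    where
    p∤x : ¬ + p ∣ x
    p∤x p∣x = p∤a (∣-resp-≡-mod x*x≡a (ℤD.∣m⇒∣m*n x p∣x))
    x⁻¹ = proj₁ (∤⇒inverse p∤x)
    x*x⁻¹≡1 = proj₂ (∤⇒inverse p∤x)
    no-root : ∀ y → ¬ y * y ≡ a * b mod p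
    no-root y y*y≡ab = b-no-root (y * x⁻¹) (begin
      y * x⁻¹ * (y * x⁻¹)           ≡⟨ regroup₁ y x⁻¹ ⟩
      y * y * (x⁻¹ * x⁻¹)           ≈⟨ *-cong-mod y*y≡ab mod-refl ⟩
      a * b * (x⁻¹ * x⁻¹)           ≈⟨ *-cong-mod (*-cong-mod (mod-sym x*x≡a) mod-refl) mod-refl ⟩
      x * x * b * (x⁻¹ * x⁻¹)       ≡⟨ regroup₂ x b x⁻¹ ⟩
      x * x⁻¹ * (x * x⁻¹) * b       ≈⟨ *-cong-mod (*-cong-mod x*x⁻¹≡1 x*x⁻¹≡1) mod-refl ⟩
      + 1 * + 1 * b                 ≡⟨ ℤP.*-identityˡ b ⟩
      b                             ∎)
      where
      open ModReasoning p
      regroup₁ : ∀ y z → y * z * (y * z) ≡ y * y * (z * z)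
      regroup₁ = solve-∀
      regroup₂ : ∀ x b z → x * x * b * (z * z) ≡ x * z * (x * z) * b
      regroup₂ = solve-∀

  0<p : 0 ℕ.< p
  0<p = ℕ.>-nonZero⁻¹ p

  #roots : ℤ → ℤ
  #roots a = sumL (upTo p) (λ x → indicator (+ x * + x ≡? a mod p))

  #roots-divisible : ∀ {a} → + p ∣ a → #roots a ≡ + 1
  #roots-divisible {a} p∣a = begin
    #roots a                                   ≡⟨ sumL-cong (upTo p) (λ x∈ → indicator-cong (root⇒0 (∈-upTo⁻ x∈)) 0⇒root _ _) ⟩
    sumL (upTo p) (λ x → indicator (x ℕ.≟ 0))  ≡⟨ sumL-indicator-≡ ℕ._≟_ (Unique.upTo⁺ p) (∈-upTo⁺ 0<p) ⟩
    + 1                                        ∎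
    where
    open ≡-Reasoning
    root⇒0 : ∀ {x} → x ℕ.< p → + x * + x ≡ a mod p → x ≡ 0
    root⇒0 x<p x*x≡a = ≡-mod⇒≡ p x<p 0<p (∣⇒≡0-mod (∣-square (∣-resp-≡-mod (mod-sym x*x≡a) p∣a)))
    0⇒root : ∀ {x} → x ≡ 0 → + x * + x ≡ a mod p
    0⇒root refl = mod-sym (∣⇒≡0-mod p∣a)

  #roots-nonresidue : ∀ {a} → (∀ x → ¬ x * x ≡ a mod p) → #roots a ≡ + 0
  #roots-nonresidue {a} no-root = sumL-0 (upTo p) λ {x} _ → no-root-indicator x
    where
    no-root-indicator : ∀ x → indicator (+ x * + x ≡? a mod p) ≡ + 0
    no-root-indicator x with + x * + x ≡? a mod p
    ... | yes x*x≡a = contradiction x*x≡a (no-root (+ x))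
    ... | no _      = refl

  square-root⇒±root : ∀ {x} z → x ℕ.< p → + x * + x ≡ z * z mod p → x ≡ z %ℕ p ⊎ x ≡ (- z) %ℕ p
  square-root⇒±root {x} z x<p x*x≡z*z with ∣-euclid (subst (+ p ∣_) (difference-of-squares (+ x) z) (divides-difference x*x≡z*z))
    where
    difference-of-squares : ∀ x z → x * x - z * z ≡ (x - z) * (x + z)
    difference-of-squares = solve-∀
  ... | inj₁ p∣x-z = inj₁ (≡-mod⇒≡ p x<p (n%ℕd<d z p) (mod-trans (mod-intro p∣x-z) (mod-sym (%ℕ-≡-mod p z))))
  ... | inj₂ p∣x+z = inj₂ (≡-mod⇒≡ p x<p (n%ℕd<d (- z) p)
                            (mod-trans (mod-intro (subst (+ p ∣_) (minus-neg (+ x) z) p∣x+z)) (mod-sym (%ℕ-≡-mod p (- z)))))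
    where
    minus-neg : ∀ x z → x + z ≡ x - - z
    minus-neg = solve-∀

  ≢-mod-neg : ∀ {z} → ¬ + p ∣ z → ¬ z ≡ - z mod p
  ≢-mod-neg {z} p∤z z≡-z = [ ∤-prime prime[2] p≢2 , p∤z ]′ (∣-euclid (subst (+ p ∣_) (doubling z) (divides-difference z≡-z)))
    where
    doubling : ∀ z → z - - z ≡ + 2 * z
    doubling = solve-∀

  root≢-root : ∀ z → ¬ + p ∣ z → z %ℕ p ≢ (- z) %ℕ p
  root≢-root z p∤z z₀≡z₁ =
    ≢-mod-neg p∤z (mod-trans (mod-sym (%ℕ-≡-mod p z)) (subst (λ w → + w ≡ - z mod p) (sym z₀≡z₁) (%ℕ-≡-mod p (- z))))

  #roots-residue : ∀ {a} z → ¬ + p ∣ a → z * z ≡ a mod p → #roots a ≡ + 2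
  #roots-residue {a} z p∤a z*z≡a = begin
    #roots a                                                           ≡⟨ sumL-cong (upTo p) (λ x∈ → split (∈-upTo⁻ x∈)) ⟩
    sumL (upTo p) (λ x → indicator (x ℕ.≟ z₀) + indicator (x ℕ.≟ z₁))  ≡⟨ sumL-+ (upTo p) _ _ ⟩
    sumL (upTo p) (λ x → indicator (x ℕ.≟ z₀)) + sumL (upTo p) (λ x → indicator (x ℕ.≟ z₁))
      ≡⟨ cong₂ _+_ (sumL-indicator-≡ ℕ._≟_ (Unique.upTo⁺ p) (∈-upTo⁺ (n%ℕd<d z p)))
                   (sumL-indicator-≡ ℕ._≟_ (Unique.upTo⁺ p) (∈-upTo⁺ (n%ℕd<d (- z) p))) ⟩
    + 2                                                                ∎
    where
    open ≡-Reasoning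
    z₀ = z %ℕ p
    z₁ = (- z) %ℕ p
    neg-square : ∀ z → z * z ≡ - z * - z
    neg-square = solve-∀
    z₀-root : + z₀ * + z₀ ≡ a mod p
    z₀-root = mod-trans (*-cong-mod (%ℕ-≡-mod p z) (%ℕ-≡-mod p z)) z*z≡a
    z₁-root : + z₁ * + z₁ ≡ a mod p
    z₁-root = mod-trans (*-cong-mod (%ℕ-≡-mod p (- z)) (%ℕ-≡-mod p (- z))) (subst (_≡ a mod p) (neg-square z) z*z≡a)
    p∤z : ¬ + p ∣ z
    p∤z p∣z = p∤a (∣-resp-≡-mod z*z≡a (ℤD.∣m⇒∣m*n z p∣z))
    split : ∀ {x} → x ℕ.< p → indicator (+ x * + x ≡? a mod p) ≡ indicator (x ℕ.≟ z₀) + indicator (x ℕ.≟ z₁)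
    split {x} x<p = indicator-⊎ (λ x*x≡a → square-root⇒±root z x<p (mod-trans x*x≡a (mod-sym z*z≡a)))
                                (λ { refl → z₀-root }) (λ { refl → z₁-root })
                                (λ { (refl , x≡z₁) → root≢-root z p∤z x≡z₁ }) _ (x ℕ.≟ z₀) (x ℕ.≟ z₁)

  1+L≡#roots : ∀ a → + 1 + L a ≡ #roots a
  1+L≡#roots a with L a | residuosity a
  ... | _ | divisible p∣a        = sym (#roots-divisible p∣a)
  ... | _ | residue p∤a z z*z≡a  = sym (#roots-residue z p∤a z*z≡a)
  ... | _ | nonresidue _ no-root = sym (#roots-nonresidue no-root)

  -- Summing 1 + L y = #roots y over all y counts every x < p exactly once.
  sumL-L≡0 : sumL (upTo p) (λ y → L (+ y)) ≡ + 0
  sumL-L≡0 = begin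
    ΣL                   ≡⟨ cancel (+ p) ΣL ⟩
    - + p + (+ p + ΣL)   ≡⟨ cong (_+_ (- + p)) p+ΣL≡p ⟩
    - + p + + p          ≡⟨ ℤP.+-inverseˡ (+ p) ⟩
    + 0                  ∎
    where
    open ≡-Reasoning
    ΣL = sumL (upTo p) (λ y → L (+ y))
    cancel : ∀ m n → n ≡ - m + (m + n)
    cancel = solve-∀
    square-indicator : ℕ → ℕ → ℤ
    square-indicator x y = indicator (+ x * + x ≡? + y mod p)
    one-square : ∀ x → sumL (upTo p) (square-indicator x) ≡ + 1
    one-square x = begin
      sumL (upTo p) (square-indicator x)
        ≡⟨ sumL-cong (upTo p) (λ y∈ → indicator-cong (to (∈-upTo⁻ y∈)) from _ _) ⟩
      sumL (upTo p) (λ y → indicator (y ℕ.≟ (+ x * + x) %ℕ p))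
        ≡⟨ sumL-indicator-≡ ℕ._≟_ (Unique.upTo⁺ p) (∈-upTo⁺ (n%ℕd<d (+ x * + x) p)) ⟩
      + 1
        ∎
      where
      to : ∀ {y} → y ℕ.< p → + x * + x ≡ + y mod p → y ≡ (+ x * + x) %ℕ p
      to y<p x*x≡y = trans (sym (m<n⇒m%n≡m y<p)) (≡-mod⇒%ℕ≡ p (mod-sym x*x≡y))
      from : ∀ {y} → y ≡ (+ x * + x) %ℕ p → + x * + x ≡ + y mod p
      from refl = mod-sym (%ℕ-≡-mod p (+ x * + x))
    p≡Σ1 : + p ≡ sumL (upTo p) (λ _ → + 1)
    p≡Σ1 = trans (cong +_ (sym (length-upTo p))) (sym (sumL-const-1 (upTo p)))
    p+ΣL≡p : + p + ΣL ≡ + p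
    p+ΣL≡p = begin
      + p + ΣL                                                          ≡⟨ cong (_+ ΣL) p≡Σ1 ⟩
      sumL (upTo p) (λ _ → + 1) + ΣL                                    ≡⟨ sumL-+ (upTo p) (λ _ → + 1) (λ y → L (+ y)) ⟨
      sumL (upTo p) (λ y → + 1 + L (+ y))                               ≡⟨ sumL-cong (upTo p) (λ {y} _ → 1+L≡#roots (+ y)) ⟩
      sumL (upTo p) (λ y → sumL (upTo p) (λ x → square-indicator x y))  ≡⟨ sumL-swap (upTo p) (upTo p) square-indicator ⟩
      sumL (upTo p) (λ x → sumL (upTo p) (square-indicator x))          ≡⟨ sumL-cong (upTo p) (λ {x} _ → one-square x) ⟩
      sumL (upTo p) (λ _ → + 1)                                         ≡⟨ p≡Σ1 ⟨
      + p                                                               ∎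

  sumL-L-affine : ∀ {n} c → ¬ + p ∣ n → sumL (upTo p) (λ x → L (n * + x + c)) ≡ + 0
  sumL-L-affine {n} c p∤n =
    trans (sumL-cong (upTo p) (λ {x} _ → L-cong (mod-sym (%ℕ-≡-mod p (n * + x + c)))))
          (trans (sym (sumL-reindex f (λ y → L (+ y)) (Unique.upTo⁺ p) (Unique.upTo⁺ p) f-inj f-into f-onto))
                 sumL-L≡0)
    where
    f : ℕ → ℕ
    f x = (n * + x + c) %ℕ p
    n⁻¹ = proj₁ (∤⇒inverse p∤n)
    n*n⁻¹≡1 = proj₂ (∤⇒inverse p∤n)
    difference : ∀ n x y c → n * x + c - (n * y + c) ≡ n * (x - y)
    difference = solve-∀
    f-inj : ∀ {x y} → x ∈ upTo p → y ∈ upTo p → f x ≡ f y → x ≡ y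
    f-inj {x} {y} x∈ y∈ fx≡fy = ≡-mod⇒≡ p (∈-upTo⁻ x∈) (∈-upTo⁻ y∈)
      (mod-intro (∣-cancelˡ p∤n (subst (+ p ∣_) (difference n (+ x) (+ y) c)
                                        (divides-difference (%ℕ≡⇒≡-mod p (n * + x + c) (n * + y + c) fx≡fy)))))
    f-into : ∀ {x} → x ∈ upTo p → f x ∈ upTo p
    f-into {x} _ = ∈-upTo⁺ (n%ℕd<d (n * + x + c) p)
    f-onto : ∀ {y} → y ∈ upTo p → ∃ λ x → x ∈ upTo p × f x ≡ y
    f-onto {y} y∈ = x , ∈-upTo⁺ (n%ℕd<d (n⁻¹ * (+ y - c)) p) , trans (≡-mod⇒%ℕ≡ p hits-y) (m<n⇒m%n≡m (∈-upTo⁻ y∈))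
      where
      x = (n⁻¹ * (+ y - c)) %ℕ p
      regroup : ∀ n m d c → n * (m * d) + c ≡ n * m * d + c
      regroup = solve-∀
      hits-y : n * + x + c ≡ + y mod p
      hits-y = begin
        n * + x + c                ≈⟨ +-cong-mod (*-cong-mod (mod-refl {a = n}) (%ℕ-≡-mod p (n⁻¹ * (+ y - c)))) mod-refl ⟩
        n * (n⁻¹ * (+ y - c)) + c  ≡⟨ regroup n n⁻¹ (+ y - c) c ⟩
        n * n⁻¹ * (+ y - c) + c    ≈⟨ +-cong-mod (*-cong-mod n*n⁻¹≡1 mod-refl) mod-refl ⟩
        + 1 * (+ y - c) + c        ≡⟨ unit (+ y) c ⟩
        + y                        ∎
        where
        open ModReasoning p
        unit : ∀ y c → + 1 * (y - c) + c ≡ y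
        unit = solve-∀

  -- For a nonresidue a the terms L (a y) + L y are ≤ 0 and sum to 0, so they all vanish; take y = b.
  L-nonresidue*nonresidue : ∀ {a b} → ¬ + p ∣ a → (∀ x → ¬ x * x ≡ a mod p) → ¬ + p ∣ b → (∀ x → ¬ x * x ≡ b mod p) →
                            L (a * b) ≡ + 1
  L-nonresidue*nonresidue {a} {b} p∤a a-no-root p∤b b-no-root = begin
    L (a * b)                   ≡⟨ L-cong (*-cong-mod (mod-refl {a = a}) (mod-sym (%ℕ-≡-mod p b))) ⟩
    L (a * + b₀)                ≡⟨ solve-for-first (L (a * + b₀)) (L (+ b₀)) T[b₀]≡0 L[b₀]≡-1 ⟩
    + 1                         ∎
    where
    open ≡-Reasoning
    b₀ = b %ℕ p
    T : ℕ → ℤ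
    T y = L (a * + y) + L (+ y)
    T≤0 : ∀ y → T y ≤ + 0
    T≤0 y with L (+ y) | residuosity (+ y)
    ... | _ | divisible p∣y         = ℤP.≤-reflexive (cong (_+ + 0) (L-divisible (ℤD.∣n⇒∣m*n a p∣y)))
    ... | _ | residue p∤y x x*x≡y   = ℤP.≤-reflexive (cong (_+ + 1)
                                        (trans (cong L (ℤP.*-comm a (+ y))) (L-residue*nonresidue x p∤y x*x≡y p∤a a-no-root)))
    ... | _ | nonresidue _ _        = ℤP.+-monoˡ-≤ (- + 1) (L≤1 (a * + y))
    ΣT≡0 : sumL (upTo p) T ≡ + 0
    ΣT≡0 = begin
      sumL (upTo p) T                                                   ≡⟨ sumL-+ (upTo p) (λ y → L (a * + y)) (λ y → L (+ y)) ⟩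
      sumL (upTo p) (λ y → L (a * + y)) + sumL (upTo p) (λ y → L (+ y)) ≡⟨ cong₂ _+_ ΣL[a*y]≡0 sumL-L≡0 ⟩
      + 0                                                               ∎
      where
      ΣL[a*y]≡0 : sumL (upTo p) (λ y → L (a * + y)) ≡ + 0
      ΣL[a*y]≡0 = trans (sumL-cong (upTo p) (λ {y} _ → cong L (sym (ℤP.+-identityʳ (a * + y))))) (sumL-L-affine (+ 0) p∤a)
    T[b₀]≡0 : T b₀ ≡ + 0
    T[b₀]≡0 = nonpositive-sumL≡0 (upTo p) T (λ {y} _ → T≤0 y) ΣT≡0 (∈-upTo⁺ (n%ℕd<d b p))
    L[b₀]≡-1 : L (+ b₀) ≡ - + 1
    L[b₀]≡-1 = trans (L-cong (%ℕ-≡-mod p b)) (L-nonresidue p∤b b-no-root)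
    solve-for-first : ∀ u v → u + v ≡ + 0 → v ≡ - + 1 → u ≡ + 1
    solve-for-first u v u+v≡0 refl = trans (add-back u) (cong (_+ + 1) u+v≡0)
      where
      add-back : ∀ u → u ≡ u + - + 1 + + 1
      add-back = solve-∀

  L-* : ∀ a b → L (a * b) ≡ L a * L b
  L-* a b with L a | residuosity a | L b | residuosity b
  ... | _ | divisible p∣a        | _ | _                    = L-divisible (ℤD.∣m⇒∣m*n b p∣a)
  ... | _ | residue _ _ _        | _ | divisible p∣b        = L-divisible (ℤD.∣n⇒∣m*n a p∣b)
  ... | _ | nonresidue _ _       | _ | divisible p∣b        = L-divisible (ℤD.∣n⇒∣m*n a p∣b)
  ... | _ | residue p∤a x x*x≡a  | _ | residue p∤b y y*y≡b  =
    L-residue (x * y) (∤-* p∤a p∤b) (subst (_≡ a * b mod p) (regroup x y) (*-cong-mod x*x≡a y*y≡b))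
    where
    regroup : ∀ x y → x * x * (y * y) ≡ x * y * (x * y)
    regroup = solve-∀
  ... | _ | residue p∤a x x*x≡a  | _ | nonresidue p∤b b-no-root = L-residue*nonresidue x p∤a x*x≡a p∤b b-no-root
  ... | _ | nonresidue p∤a a-no-root | _ | residue p∤b y y*y≡b =
    trans (cong L (ℤP.*-comm a b)) (L-residue*nonresidue y p∤b y*y≡b p∤a a-no-root)
  ... | _ | nonresidue p∤a a-no-root | _ | nonresidue p∤b b-no-root = L-nonresidue*nonresidue p∤a a-no-root p∤b b-no-root

discriminant : ℤ → ℤ → ℤ
discriminant α β = + 4 ℤ.* (α ℤ.* α ℤ.* α) ℤ.+ + 27 ℤ.* (β ℤ.* β)

-- The pairs (α[ γ ], β[ γ ]) are the zeros of the discriminant (up to primes 2 and 3).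
α[_] : ℤ → ℤ
α[ γ ] = ℤ.- + 3 ℤ.* γ ℤ.* γ

β[_] : ℤ → ℤ
β[ γ ] = + 2 ℤ.* γ ℤ.* γ ℤ.* γ

legendre′≡legendre : ∀ a p .{{_ : NonZero p}} → legendre′ a p ≡ legendre a p
legendre′≡legendre a (suc p) = refl

module SingularCubicSum {p : ℕ} (p-prime : Prime p) (p≢2 : p ≢ 2) where
  open import Data.Integer using (_+_; _*_; -_; _-_)
  open ℤD using (_∣_)
  open ModPrime p-prime
  open Legendre p-prime p≢2
  open IntegerSum
  open import Data.List using (upTo)
  import Data.List.Relation.Unary.Unique.Propositional.Properties as Unique

  module _ {A B : ℤ} (γ : ℤ) (A≡ : A ≡ α[ γ ] mod p) (B≡ : B ≡ β[ γ ] mod p) where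

    private
      γ₀ = γ %ℕ p
      c  = L (+ γ₀ + + 2 * γ)

    cubic : ℕ → ℤ
    cubic x = + x * + x * + x + A * + x + B

    cubic-factorisation : ∀ x → cubic x ≡ (+ x - γ) * (+ x - γ) * (+ x + + 2 * γ) mod p
    cubic-factorisation x = mod-trans (+-cong-mod (+-cong-mod (mod-refl {a = + x * + x * + x}) (*-cong-mod A≡ mod-refl)) B≡)
                                      (mod-reflexive (factorisation (+ x) γ))
      where
      factorisation : ∀ x γ → x * x * x + - + 3 * γ * γ * x + + 2 * γ * γ * γ ≡ (x - γ) * (x - γ) * (x + + 2 * γ)
      factorisation = solve-∀

    L-cubic : ∀ {x} → x ℕ.< p → legendre′ (cubic x) p ≡ L (+ x + + 2 * γ) + - c * indicator (x ℕ.≟ γ₀)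
    L-cubic {x} x<p = begin
      legendre′ (cubic x) p                          ≡⟨ legendre′≡legendre (cubic x) p ⟩
      L (cubic x)                                    ≡⟨ L-cong (cubic-factorisation x) ⟩
      L ((+ x - γ) * (+ x - γ) * (+ x + + 2 * γ))    ≡⟨ L-* ((+ x - γ) * (+ x - γ)) (+ x + + 2 * γ) ⟩
      L ((+ x - γ) * (+ x - γ)) * L (+ x + + 2 * γ)  ≡⟨ double-root (x ℕ.≟ γ₀) ⟩
      L (+ x + + 2 * γ) + - c * indicator (x ℕ.≟ γ₀) ∎
      where
      open ≡-Reasoning
      double-root : (x≟γ₀ : Dec (x ≡ γ₀)) →
                    L ((+ x - γ) * (+ x - γ)) * L (+ x + + 2 * γ) ≡ L (+ x + + 2 * γ) + - c * indicator x≟γ₀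
      double-root (yes refl) = trans (cong (_* L (+ x + + 2 * γ)) (L-divisible p∣[x-γ]²)) (cancel (L (+ x + + 2 * γ)))
        where
        p∣[x-γ]² : + p ∣ (+ x - γ) * (+ x - γ)
        p∣[x-γ]² = ℤD.∣m⇒∣m*n (+ x - γ) (divides-difference (%ℕ-≡-mod p γ))
        cancel : ∀ u → + 0 * u ≡ u + - u * + 1
        cancel = solve-∀
      double-root (no x≢γ₀) = trans (cong (_* L (+ x + + 2 * γ)) (L-square p∤x-γ)) (drop (L (+ x + + 2 * γ)) c)
        where
        p∤x-γ : ¬ + p ∣ + x - γ
        p∤x-γ p∣x-γ = x≢γ₀ (≡-mod⇒≡ p x<p (n%ℕd<d γ p) (mod-trans (mod-intro p∣x-γ) (mod-sym (%ℕ-≡-mod p γ))))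
        drop : ∀ u v → + 1 * u ≡ u + - v * + 0
        drop = solve-∀

    charSum-singular : charSum p A B ≡ - (L (+ 3) * L γ)
    charSum-singular = begin
      charSum p A B                                                   ≡⟨ sumℤ-map (upTo p) _ ⟩
      sumL (upTo p) (λ x → legendre′ (cubic x) p)                     ≡⟨ sumL-cong (upTo p) (L-cubic ∘ ∈-upTo⁻) ⟩
      sumL (upTo p) (λ x → L (+ x + + 2 * γ) + - c * indicator (x ℕ.≟ γ₀))
        ≡⟨ sumL-+ (upTo p) _ _ ⟩
      sumL (upTo p) (λ x → L (+ x + + 2 * γ)) + sumL (upTo p) (λ x → - c * indicator (x ℕ.≟ γ₀))
        ≡⟨ cong₂ _+_ shifted-sum≡0 (sym (*-distribˡ-sumL (upTo p) (- c) (λ x → indicator (x ℕ.≟ γ₀)))) ⟩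
      + 0 + - c * sumL (upTo p) (λ x → indicator (x ℕ.≟ γ₀))          ≡⟨ cong (λ s → + 0 + - c * s) one-γ₀ ⟩
      + 0 + - c * + 1                                                 ≡⟨ simplify c ⟩
      - c                                                             ≡⟨ cong -_ (trans (L-cong γ₀+2γ≡3γ) (L-* (+ 3) γ)) ⟩
      - (L (+ 3) * L γ)                                               ∎
      where
      open ≡-Reasoning
      shifted-sum≡0 : sumL (upTo p) (λ x → L (+ x + + 2 * γ)) ≡ + 0
      shifted-sum≡0 = trans (sumL-cong (upTo p) (λ {x} _ → cong (λ y → L (y + + 2 * γ)) (sym (ℤP.*-identityˡ (+ x)))))
                            (sumL-L-affine (+ 2 * γ) ∤1)
      one-γ₀ : sumL (upTo p) (λ x → indicator (x ℕ.≟ γ₀)) ≡ + 1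
      one-γ₀ = sumL-indicator-≡ ℕ._≟_ (Unique.upTo⁺ p) (∈-upTo⁺ (n%ℕd<d γ p))
      simplify : ∀ u → + 0 + - u * + 1 ≡ - u
      simplify = solve-∀
      γ₀+2γ≡3γ : + γ₀ + + 2 * γ ≡ + 3 * γ mod p
      γ₀+2γ≡3γ = mod-trans (+-cong-mod (%ℕ-≡-mod p γ) mod-refl) (mod-reflexive (triple γ))
        where
        triple : ∀ γ → γ + + 2 * γ ≡ + 3 * γ
        triple = solve-∀

module JacobiSymbol where
  open import Data.Integer using (_*_)
  open import Data.Nat.Divisibility using (_∣_; _∣?_)
  open import Data.Nat.Primality using (prime?)
  open import Data.List using (upTo; applyUpTo)
  import Data.List.Properties as List
  open import Data.List.Membership.Propositional.Properties using (∈-filter⁺; ∈-filter⁻; ∈-applyUpTo⁻)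
  open import Relation.Nullary.Decidable using (_×-dec_)

  prodℤ-cong : ∀ (xs : List A) {f g : A → ℤ} → (∀ {x} → x ∈ xs → f x ≡ g x) → prodℤ (map f xs) ≡ prodℤ (map g xs)
  prodℤ-cong []       f≡g = refl
  prodℤ-cong (x ∷ xs) f≡g = cong₂ _*_ (f≡g (here refl)) (prodℤ-cong xs (f≡g ∘ there))

  prodℤ-* : ∀ (xs : List A) (f g : A → ℤ) → prodℤ (map (λ x → f x * g x) xs) ≡ prodℤ (map f xs) * prodℤ (map g xs)
  prodℤ-* []       f g = refl
  prodℤ-* (x ∷ xs) f g = trans (cong (f x * g x *_) (prodℤ-* xs f g)) (interchange (f x) (g x) _ _)
    where
    interchange : ∀ a b c d → a * b * (c * d) ≡ a * c * (b * d)
    interchange = solve-∀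

  prodℤ-zero : ∀ (xs : List A) (f : A → ℤ) {x} → x ∈ xs → f x ≡ + 0 → prodℤ (map f xs) ≡ + 0
  prodℤ-zero (y ∷ xs) f (here refl) fx≡0 = cong (_* prodℤ (map f xs)) fx≡0
  prodℤ-zero (y ∷ xs) f (there x∈) fx≡0 = trans (cong (f y *_) (prodℤ-zero xs f x∈ fx≡0)) (ℤP.*-zeroʳ (f y))

  ∈-primeDivisors⁻ : ∀ {p n} → p ∈ primeDivisors n → Prime p × p ∣ n
  ∈-primeDivisors⁻ {n = n} p∈ = proj₂ (∈-filter⁻ (λ q → prime? q ×-dec (q ∣? n)) {xs = upTo (suc n)} p∈)

  ∈-primeDivisors⁺ : ∀ {p n} .{{_ : NonZero n}} → Prime p → p ∣ n → p ∈ primeDivisors n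
  ∈-primeDivisors⁺ {n = n} p-prime p∣n =
    ∈-filter⁺ (λ q → prime? q ×-dec (q ∣? n)) (∈-upTo⁺ (ℕ.s≤s (ℕD.∣⇒≤ p∣n))) (p-prime , p∣n)

  squarefree⇒val≡1 : ∀ {p r} → Squarefree r → Prime p → p ∣ r → val p r ≡ 1
  squarefree⇒val≡1 {p} {zero}   sf _ _ = contradiction refl (squarefree⇒≢0 sf)
  squarefree⇒val≡1 {p} {suc r′} sf p-prime p∣r =
    cong length (trans (List.filter-accept (λ i → (p ℕ.^ suc i) ∣? suc r′) p¹∣r)
                       (cong (0 ∷_) (List.filter-none (λ i → (p ℕ.^ suc i) ∣? suc r′) (All.tabulate p²∤r))))
    where
    p¹∣r : p ℕ.^ 1 ∣ suc r′
    p¹∣r = subst (_∣ suc r′) (sym (ℕP.*-identityʳ p)) p∣r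
    p²∤r : ∀ {j} → j ∈ applyUpTo suc r′ → ¬ p ℕ.^ suc j ∣ suc r′
    p²∤r j∈ p^j∣r with i , _ , refl ← ∈-applyUpTo⁻ suc j∈ =
      contradiction (sf p (ℕD.∣-trans (subst (p ℕ.* p ∣_) (ℕP.*-assoc p p _) (ℕD.m∣m*n _)) p^j∣r)) (ℕP.>⇒≢ (prime>1 p-prime))

  jacobi-squarefree : ∀ a {r} → Squarefree r → jacobi a r ≡ prodℤ (map (legendre′ a) (primeDivisors r))
  jacobi-squarefree a {r} sf = prodℤ-cong (primeDivisors r) λ {p} p∈ →
    let p-prime , p∣r = ∈-primeDivisors⁻ p∈ in
    trans (cong (powℤ (legendre′ a p)) (squarefree⇒val≡1 sf p-prime p∣r)) (ℤP.*-identityʳ (legendre′ a p))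

open JacobiSymbol

module SqrtLambda where
  open import Data.Integer using (_+_; _*_; -_)
  open import Data.Nat.Divisibility using (_∣_)
  open import Data.Nat.Primality using (prime?; prime⇒nonZero)
  open import Data.Sum using ([_,_]′)
  open import Function using (id)
  open import Relation.Nullary.Decidable using (toWitness; toWitnessFalse)

  odd⇒divisor≢2 : ∀ {p r} → Odd r → p ∣ r → p ≢ 2
  odd⇒divisor≢2 r-odd p∣r refl = r-odd p∣r

  sqrtLambda-singular : ∀ {r A B} γ → Squarefree r → Odd r → A ≡ α[ γ ] mod r → B ≡ β[ γ ] mod r →
                        sqrtLambda r A B ≡ jacobi (+ 3) r * jacobi γ r
  sqrtLambda-singular {r} {A} {B} γ sf r-odd A≡ B≡ = begin
    sqrtLambda r A B
      ≡⟨ prodℤ-cong (primeDivisors r) local ⟩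
    prodℤ (map (λ p → legendre′ (+ 3) p * legendre′ γ p) (primeDivisors r))
      ≡⟨ prodℤ-* (primeDivisors r) _ _ ⟩
    prodℤ (map (legendre′ (+ 3)) (primeDivisors r)) * prodℤ (map (legendre′ γ) (primeDivisors r))
      ≡⟨ cong₂ _*_ (jacobi-squarefree (+ 3) sf) (jacobi-squarefree γ sf) ⟨
    jacobi (+ 3) r * jacobi γ r
      ∎
    where
    open ≡-Reasoning
    local : ∀ {p} → p ∈ primeDivisors r → - charSum p A B ≡ legendre′ (+ 3) p * legendre′ γ p
    local {p} p∈ = begin
      - charSum p A B                           ≡⟨ cong -_ (charSum-singular γ (mod-weaken p∣r A≡) (mod-weaken p∣r B≡)) ⟩
      - - (legendre (+ 3) p * legendre γ p)     ≡⟨ ℤP.neg-involutive _ ⟩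
      legendre (+ 3) p * legendre γ p           ≡⟨ cong₂ _*_ (legendre′≡legendre (+ 3) p) (legendre′≡legendre γ p) ⟨
      legendre′ (+ 3) p * legendre′ γ p         ∎
      where
      p-prime = proj₁ (∈-primeDivisors⁻ {n = r} p∈)
      p∣r = proj₂ (∈-primeDivisors⁻ {n = r} p∈)
      instance _ = prime⇒nonZero p-prime
      open SingularCubicSum p-prime (odd⇒divisor≢2 r-odd p∣r)

  3-prime : Prime 3
  3-prime = toWitness {a? = prime? 3} _

  cube≡-mod-3 : ∀ b → b * b * b ≡ b mod 3
  cube≡-mod-3 b = mod-trans (*-cong-mod (*-cong-mod b≡r b≡r) b≡r) (mod-trans (residue-cube (b %ℕ 3) (n%ℕd<d b 3)) r≡b)
    where
    r≡b = %ℕ-≡-mod 3 b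
    b≡r = mod-sym r≡b
    residue-cube : ∀ r → r ℕ.< 3 → + r * + r * + r ≡ + r mod 3
    residue-cube 0 _ = mod-refl
    residue-cube 1 _ = mod-refl
    residue-cube 2 _ = mod-intro (divides (+ 2) refl)
    residue-cube (suc (suc (suc _))) (ℕ.s≤s (ℕ.s≤s (ℕ.s≤s ())))

  -- Modulo 3 the pair is singular with γ = 2β (as β³ ≡ β), and L 3 = 0.
  charSum-3 : ∀ {α} β → + 3 ℤD.∣ α → charSum 3 α β ≡ + 0
  charSum-3 {α} β 3∣α = trans (charSum-singular γ α≡ β≡) (cong -_ (ℤP.*-zeroˡ (legendre γ 3)))
    where
    open SingularCubicSum 3-prime (λ ())
    γ = + 2 * β
    α≡ : α ≡ α[ γ ] mod 3
    α≡ = mod-trans (∣⇒≡0-mod 3∣α) (mod-sym (∣⇒≡0-mod (ℤD.∣m⇒∣m*n γ (ℤD.∣m⇒∣m*n γ (divides (- + 1) refl)))))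
    expand : ∀ β → + 2 * (+ 2 * β) * (+ 2 * β) * (+ 2 * β) ≡ β * β * β + (+ 5 * (β * β * β)) * + 3
    expand = solve-∀
    β≡ : β ≡ β[ γ ] mod 3
    β≡ = mod-sym (mod-trans (mod-reflexive (expand β))
                   (mod-trans (+-cong-mod (cube≡-mod-3 β) (multiple-≡0-mod (+ 5 * (β * β * β)))) (mod-reflexive (ℤP.+-identityʳ β))))

  jacobi-3≡0 : ∀ {r} → Squarefree r → 3 ∣ r → jacobi (+ 3) r ≡ + 0
  jacobi-3≡0 {r} sf 3∣r = trans (jacobi-squarefree (+ 3) sf)
    (prodℤ-zero (primeDivisors r) (legendre′ (+ 3)) (∈-primeDivisors⁺ {{ℕ.≢-nonZero (squarefree⇒≢0 sf)}} 3-prime 3∣r) refl)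

  sqrtLambda-3≡0 : ∀ {r α} β → Squarefree r → 3 ∣ r → + 3 ℤD.∣ α → sqrtLambda r α β ≡ + 0
  sqrtLambda-3≡0 {r} {α} β sf 3∣r 3∣α = prodℤ-zero (primeDivisors r) (λ p → - charSum p α β)
    (∈-primeDivisors⁺ {{ℕ.≢-nonZero (squarefree⇒≢0 sf)}} 3-prime 3∣r) (cong -_ (charSum-3 β 3∣α))

  3∣discriminant⇒3∣α : ∀ α β → + 3 ℤD.∣ discriminant α β → + 3 ℤD.∣ α
  3∣discriminant⇒3∣α α β 3∣D = [ ∣-square , id ]′ (∣-euclid (∣-cancelˡ 3∤4 (ℤD.∣m+n∣n⇒∣m 3∣D 3∣27β²)))
    where
    open ModPrime 3-prime
    3∤4 : ¬ + 3 ℤD.∣ + 4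
    3∤4 = toWitnessFalse {a? = + 3 ℤD.∣? + 4} _
    3∣27β² : + 3 ℤD.∣ + 27 * (β * β)
    3∣27β² = divides (+ 9 * (β * β)) (regroup (β * β))
      where
      regroup : ∀ x → + 27 * x ≡ + 9 * x * + 3
      regroup = solve-∀

open SqrtLambda

module DiscriminantPairs where
  open import Data.Integer using (_+_; _*_)
  open import Data.Nat.Divisibility using (_∣_; _∣?_)
  open import Data.List using (upTo; concatMap; cartesianProduct; _++_)
  open import Data.List.Membership.Propositional.Properties using (∈-filter⁺; ∈-filter⁻; ∈-cartesianProduct⁺; ∈-cartesianProduct⁻)
  import Data.List.Relation.Unary.Unique.Propositional.Properties as Unique
  -- discPairs does not use the ring, so any instance will do
  open InRing ℤP.+-*-commutativeRing using (discPairs)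

  pos-discriminant : ∀ a b → + (4 ℕ.* a ℕ.^ 3 ℕ.+ 27 ℕ.* b ℕ.^ 2) ≡ discriminant (+ a) (+ b)
  pos-discriminant a b = begin
    + (4 ℕ.* a ℕ.^ 3 ℕ.+ 27 ℕ.* b ℕ.^ 2)
      ≡⟨ ℤP.pos-+ (4 ℕ.* a ℕ.^ 3) (27 ℕ.* b ℕ.^ 2) ⟩
    + (4 ℕ.* a ℕ.^ 3) + + (27 ℕ.* b ℕ.^ 2)
      ≡⟨ cong₂ _+_ (ℤP.pos-* 4 (a ℕ.^ 3)) (ℤP.pos-* 27 (b ℕ.^ 2)) ⟩
    + 4 * + (a ℕ.^ 3) + + 27 * + (b ℕ.^ 2)
      ≡⟨ cong₂ (λ x y → + 4 * x + + 27 * y) (pos-cube a) (pos-square b) ⟩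
    discriminant (+ a) (+ b)
      ∎
    where
    open ≡-Reasoning
    pos-square : ∀ a → + (a ℕ.^ 2) ≡ + a * + a
    pos-square a = trans (cong +_ (cong (a ℕ.*_) (ℕP.*-identityʳ a))) (ℤP.pos-* a a)
    pos-cube : ∀ a → + (a ℕ.^ 3) ≡ + a * + a * + a
    pos-cube a = trans (cong +_ (trans (cong (a ℕ.*_) (cong (a ℕ.*_) (ℕP.*-identityʳ a))) (sym (ℕP.*-assoc a a a))))
                       (trans (ℤP.pos-* (a ℕ.* a) a) (cong (_* + a) (ℤP.pos-* a a)))

  concatMap≡cartesianProduct : ∀ (xs ys : List ℕ) → concatMap (λ a → map (a ,_) ys) xs ≡ cartesianProduct xs ys
  concatMap≡cartesianProduct []       ys = refl
  concatMap≡cartesianProduct (x ∷ xs) ys = cong (map (x ,_) ys ++_) (concatMap≡cartesianProduct xs ys)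

  module _ (r : ℕ) where
    private
      square = concatMap (λ a → map (a ,_) (upTo r)) (upTo r)
      r∣D? = λ (ab : ℕ × ℕ) → r ∣? (4 ℕ.* proj₁ ab ℕ.^ 3 ℕ.+ 27 ℕ.* proj₂ ab ℕ.^ 2)

    ∈-discPairs⁻ : ∀ {a b} → (a , b) ∈ discPairs r → a ℕ.< r × b ℕ.< r × + r ℤD.∣ discriminant (+ a) (+ b)
    ∈-discPairs⁻ {a} {b} ab∈ with ∈-filter⁻ r∣D? {xs = square} ab∈
    ... | ab∈square , r∣D
      with ∈-cartesianProduct⁻ (upTo r) (upTo r) (subst ((a , b) ∈_) (concatMap≡cartesianProduct (upTo r) (upTo r)) ab∈square)
    ...   | a∈ , b∈ = ∈-upTo⁻ a∈ , ∈-upTo⁻ b∈ , subst (+ r ℤD.∣_) (pos-discriminant a b) (∣ᵤ⇒∣ r∣D)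

    ∈-discPairs⁺ : ∀ {a b} → a ℕ.< r → b ℕ.< r → + r ℤD.∣ discriminant (+ a) (+ b) → (a , b) ∈ discPairs r
    ∈-discPairs⁺ {a} {b} a<r b<r r∣D = ∈-filter⁺ r∣D? {xs = square}
      (subst ((a , b) ∈_) (sym (concatMap≡cartesianProduct (upTo r) (upTo r))) (∈-cartesianProduct⁺ (∈-upTo⁺ a<r) (∈-upTo⁺ b<r)))
      (∣⇒∣ᵤ (subst (+ r ℤD.∣_) (sym (pos-discriminant a b)) r∣D))

    discPairs-unique : Unique (discPairs r)
    discPairs-unique = Unique.filter⁺ r∣D? (subst Unique (sym (concatMap≡cartesianProduct (upTo r) (upTo r)))
                                                   (Unique.cartesianProduct⁺ (Unique.upTo⁺ r) (Unique.upTo⁺ r)))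

open DiscriminantPairs

module SingularPairsModPrime {q : ℕ} (q-prime : Prime q) (q≢2 : q ≢ 2) (q≢3 : q ≢ 3) where
  open import Data.Integer using (_+_; _*_; -_; _-_)
  open ℤD using (_∣_; _∣?_)
  open import Data.Nat.Primality using (prime[2])
  open ModPrime q-prime

  q∤2 : ¬ + q ∣ + 2
  q∤2 = ∤-prime prime[2] q≢2

  q∤3 : ¬ + q ∣ + 3
  q∤3 = ∤-prime 3-prime q≢3

  square∧cube-injective : ∀ x y → + q ∣ y * y - x * x → + q ∣ x * x * x - y * y * y → x ≡ y mod q
  square∧cube-injective x y q∣y²-x² q∣x³-y³ with + q ∣? x
  ... | yes q∣x = mod-intro (ℤD.∣m∣n⇒∣m-n q∣x q∣y)
    where
    regroup : ∀ x y → x * x + (y * y - x * x) ≡ y * y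
    regroup = solve-∀
    q∣y : + q ∣ y
    q∣y = ∣-square (subst (+ q ∣_) (regroup x y) (ℤD.∣m∣n⇒∣m+n (ℤD.∣m⇒∣m*n x q∣x) q∣y²-x²))
  ... | no q∤x = mod-intro (∣-cancelˡ (∤-* q∤x q∤x)
                   (subst (+ q ∣_) (regroup x y) (ℤD.∣m∣n⇒∣m+n q∣x³-y³ (ℤD.∣n⇒∣m*n y q∣y²-x²))))
    where
    regroup : ∀ x y → (x * x * x - y * y * y) + y * (y * y - x * x) ≡ x * x * (x - y)
    regroup = solve-∀

  α-β-injective : ∀ {x y} → α[ x ] ≡ α[ y ] mod q → β[ x ] ≡ β[ y ] mod q → x ≡ y mod q
  α-β-injective {x} {y} αx≡αy βx≡βy = square∧cube-injective x y
    (∣-cancelˡ q∤3 (subst (+ q ∣_) (factor-3 x y) (divides-difference αx≡αy)))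
    (∣-cancelˡ q∤2 (subst (+ q ∣_) (factor-2 x y) (divides-difference βx≡βy)))
    where
    factor-3 : ∀ x y → - + 3 * x * x - - + 3 * y * y ≡ + 3 * (y * y - x * x)
    factor-3 = solve-∀
    factor-2 : ∀ x y → + 2 * x * x * x - + 2 * y * y * y ≡ + 2 * (x * x * x - y * y * y)
    factor-2 = solve-∀

  q∤4 : ¬ + q ∣ + 4
  q∤4 = ∤-* {+ 2} {+ 2} q∤2 q∤2

  q∤27 : ¬ + q ∣ + 27
  q∤27 = ∤-* {+ 3} {+ 9} q∤3 (∤-* {+ 3} {+ 3} q∤3 q∤3)

  -- γ = -3β/(2α) when q ∤ α, and γ ≡ 0 otherwise
  α-β-surjective : ∀ {α β} u → + q ∣ discriminant α β → (¬ + q ∣ α → + 2 * α * u ≡ + 1 mod q) →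
                   α ≡ α[ - + 3 * β * u ] mod q × β ≡ β[ - + 3 * β * u ] mod q
  α-β-surjective {α} {β} u q∣D 2αu≡1 with + q ∣? α
  ... | yes q∣α = mod-intro (ℤD.∣m∣n⇒∣m-n q∣α (ℤD.∣n⇒∣m*n (- + 3 * γ) q∣γ))
                , mod-intro (ℤD.∣m∣n⇒∣m-n q∣β (ℤD.∣n⇒∣m*n (+ 2 * γ * γ) q∣γ))
    where
    q∣β : + q ∣ β
    q∣β = ∣-square (∣-cancelˡ q∤27 (ℤD.∣m+n∣m⇒∣n q∣D (ℤD.∣n⇒∣m*n (+ 4) (ℤD.∣n⇒∣m*n (α * α) q∣α))))
    γ = - + 3 * β * u
    q∣γ : + q ∣ γ
    q∣γ = ℤD.∣m⇒∣m*n u (ℤD.∣n⇒∣m*n (- + 3) q∣β)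
  ... | no q∤α = mod-intro (∣-cancelˡ (∤-* (∤-* q∤4 q∤α) q∤α) (subst (+ q ∣_) (α-identity α β u) q∣α-side))
               , mod-intro (∣-cancelˡ (∤-* (∤-* (∤-* q∤8 q∤α) q∤α) q∤α) (subst (+ q ∣_) (β-identity α β u) q∣β-side))
    where
    w≡1 : + 2 * α * u ≡ + 1 mod q
    w≡1 = 2αu≡1 q∤α
    q∤8 : ¬ + q ∣ + 8
    q∤8 = ∤-* {+ 2} {+ 4} q∤2 q∤4
    α-identity : ∀ α β u → + 4 * (α * α * α) + + 27 * (β * β) + + 27 * β * β * (+ 2 * α * u * (+ 2 * α * u) - + 1)
                           ≡ + 4 * α * α * (α - - + 3 * (- + 3 * β * u) * (- + 3 * β * u))
    α-identity = solve-∀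
    β-identity : ∀ α β u → + 2 * β * (+ 4 * (α * α * α) + + 27 * (β * β))
                             + + 54 * β * β * β * (+ 2 * α * u * (+ 2 * α * u) * (+ 2 * α * u) - + 1)
                           ≡ + 8 * α * α * α * (β - + 2 * (- + 3 * β * u) * (- + 3 * β * u) * (- + 3 * β * u))
    β-identity = solve-∀
    q∣α-side : + q ∣ discriminant α β + + 27 * β * β * (+ 2 * α * u * (+ 2 * α * u) - + 1)
    q∣α-side = ℤD.∣m∣n⇒∣m+n q∣D (ℤD.∣n⇒∣m*n (+ 27 * β * β) (divides-difference (*-cong-mod w≡1 w≡1)))
    q∣β-side : + q ∣ + 2 * β * discriminant α β + + 54 * β * β * β * (+ 2 * α * u * (+ 2 * α * u) * (+ 2 * α * u) - + 1)
    q∣β-side = ℤD.∣m∣n⇒∣m+n (ℤD.∣n⇒∣m*n (+ 2 * β) q∣D)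
                            (ℤD.∣n⇒∣m*n (+ 54 * β * β * β) (divides-difference (*-cong-mod (*-cong-mod w≡1 w≡1) w≡1)))

module Parametrisation {r : ℕ} .{{_ : NonZero r}} (r-squarefree : Squarefree r) (r-odd : Odd r) (3∤r : ¬ 3 ℕD.∣ r) where
  open import Data.Integer using (_+_; _*_; -_; _-_)
  open import Data.Nat.Divisibility using (_∣_; divides)
  open import Data.Nat.Primality using (prime[2]; prime⇒irreducible; euclidsLemma)
  open import Data.Nat.Coprimality as Coprimality using (Coprime)
  open import Data.Nat.GCD using (gcd; gcd[m,n]∣m; gcd[m,n]∣n; gcd-greatest)
  open import Data.List using (upTo)
  open import Data.Sum using (inj₁; inj₂)
  open import Data.Empty using (⊥)
  open InRing ℤP.+-*-commutativeRing using (discPairs)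

  param : ℕ → ℕ × ℕ
  param g = α[ + g ] %ℕ r , β[ + g ] %ℕ r

  divisor≢3 : ∀ {q} → q ∣ r → q ≢ 3
  divisor≢3 q∣r refl = 3∤r q∣r

  module Local {q} (q-prime : Prime q) (q∣r : q ∣ r) =
    SingularPairsModPrime q-prime (odd⇒divisor≢2 r-odd q∣r) (divisor≢3 q∣r)

  α-cong-mod : ∀ {x y n} → x ≡ y mod n → α[ x ] ≡ α[ y ] mod n
  α-cong-mod x≡y = *-cong-mod (*-cong-mod (mod-refl {a = - + 3}) x≡y) x≡y

  β-cong-mod : ∀ {x y n} → x ≡ y mod n → β[ x ] ≡ β[ y ] mod n
  β-cong-mod x≡y = *-cong-mod (*-cong-mod (*-cong-mod (mod-refl {a = + 2}) x≡y) x≡y) x≡y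

  param-∈ : ∀ g → param g ∈ discPairs r
  param-∈ g = ∈-discPairs⁺ r (n%ℕd<d α[ + g ] r) (n%ℕd<d β[ + g ] r) (≡0-mod⇒∣ (begin
    discriminant (+ α₀) (+ β₀)        ≈⟨ +-cong-mod (*-cong-mod (mod-refl {a = + 4}) (*-cong-mod (*-cong-mod α₀≡ α₀≡) α₀≡))
                                                    (*-cong-mod (mod-refl {a = + 27}) (*-cong-mod β₀≡ β₀≡)) ⟩
    discriminant α[ + g ] β[ + g ]    ≡⟨ singular (+ g) ⟩
    + 0                               ∎))
    where
    open ModReasoning r
    α₀ = α[ + g ] %ℕ r
    β₀ = β[ + g ] %ℕ r
    α₀≡ = %ℕ-≡-mod r α[ + g ]
    β₀≡ = %ℕ-≡-mod r β[ + g ]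
    singular : ∀ γ → + 4 * (- + 3 * γ * γ * (- + 3 * γ * γ) * (- + 3 * γ * γ)) + + 27 * (+ 2 * γ * γ * γ * (+ 2 * γ * γ * γ)) ≡ + 0
    singular = solve-∀

  param-injective : ∀ {x y} → x ∈ upTo r → y ∈ upTo r → param x ≡ param y → x ≡ y
  param-injective {x} {y} x∈ y∈ param-x≡param-y =
    ≡-mod⇒≡ r (∈-upTo⁻ x∈) (∈-upTo⁻ y∈) (squarefree-≡-mod r-squarefree λ q-prime q∣r →
      Local.α-β-injective q-prime q∣r (mod-weaken q∣r αx≡αy) (mod-weaken q∣r βx≡βy))
    where
    αx≡αy = %ℕ≡⇒≡-mod r α[ + x ] α[ + y ] (cong proj₁ param-x≡param-y)
    βx≡βy = %ℕ≡⇒≡-mod r β[ + x ] β[ + y ] (cong proj₂ param-x≡param-y)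

  -- u inverts 2a modulo s = r / gcd(a, r), which is coprime to 2a since r is odd and squarefree
  ∃-inverse-of-2a : ∀ a → ∃ λ u → ∀ {q} → Prime q → q ∣ r → ¬ + q ℤD.∣ + a → + 2 * + a * u ≡ + 1 mod q
  ∃-inverse-of-2a a with gcd[m,n]∣n a r
  ... | divides s r≡s*g = u , 2au≡1
    where
    g = gcd a r
    s∣r : s ∣ r
    s∣r = divides g (trans r≡s*g (ℕP.*-comm s g))
    s≢0 : s ≢ 0
    s≢0 refl = squarefree⇒≢0 r-squarefree r≡s*g
    no-common-prime : ∀ {t} → Prime t → t ∣ 2 ℕ.* a → t ∣ s → ⊥
    no-common-prime {t} t-prime t∣2a t∣s with euclidsLemma 2 a t-prime t∣2a
    ... | inj₂ t∣a = contradiction (r-squarefree t (subst (t ℕ.* t ∣_) (sym r≡s*g) (ℕD.*-pres-∣ t∣s (gcd-greatest t∣a t∣r))))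
                                   (ℕP.>⇒≢ (prime>1 t-prime))
      where
      t∣r = ℕD.∣-trans t∣s s∣r
    ... | inj₁ t∣2 with prime⇒irreducible prime[2] t∣2
    ...   | inj₁ refl = contradiction t-prime λ ()
    ...   | inj₂ refl = r-odd (ℕD.∣-trans t∣s s∣r)
    s⊥2a : Coprime s (2 ℕ.* a)
    s⊥2a = Coprimality.sym (no-common-prime⇒coprime s≢0 no-common-prime)
    u = proj₁ (coprime⇒inverse s⊥2a)
    2au≡1-mod-s : + 2 * + a * u ≡ + 1 mod s
    2au≡1-mod-s = subst (λ x → x * u ≡ + 1 mod s) (ℤP.pos-* 2 a) (proj₂ (coprime⇒inverse s⊥2a))
    2au≡1 : ∀ {q} → Prime q → q ∣ r → ¬ + q ℤD.∣ + a → + 2 * + a * u ≡ + 1 mod q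
    2au≡1 {q} q-prime q∣r q∤a with euclidsLemma s g q-prime (subst (q ∣_) r≡s*g q∣r)
    ... | inj₁ q∣s = mod-weaken q∣s 2au≡1-mod-s
    ... | inj₂ q∣g = contradiction (∣ᵤ⇒∣ (ℕD.∣-trans q∣g (gcd[m,n]∣m a r))) q∤a

  param-onto : ∀ {ab} → ab ∈ discPairs r → ∃ λ g → g ∈ upTo r × param g ≡ ab
  param-onto {a , b} ab∈ with ∈-discPairs⁻ r ab∈ | ∃-inverse-of-2a a
  ... | a<r , b<r , r∣D | u , 2au≡1 = γ %ℕ r , ∈-upTo⁺ (n%ℕd<d γ r) , cong₂ _,_ reduces-a reduces-b
    where
    γ = - + 3 * + b * u
    local : ∀ {q} → Prime q → q ∣ r → + a ≡ α[ γ ] mod q × + b ≡ β[ γ ] mod q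
    local q-prime q∣r = Local.α-β-surjective q-prime q∣r u (ℤD.∣-trans (∣ᵤ⇒∣ q∣r) r∣D) (2au≡1 q-prime q∣r)
    a≡α[γ] : + a ≡ α[ γ ] mod r
    a≡α[γ] = squarefree-≡-mod r-squarefree (λ q-prime q∣r → proj₁ (local q-prime q∣r))
    b≡β[γ] : + b ≡ β[ γ ] mod r
    b≡β[γ] = squarefree-≡-mod r-squarefree (λ q-prime q∣r → proj₂ (local q-prime q∣r))
    γ₀≡γ = %ℕ-≡-mod r γ
    reduces-a : α[ + (γ %ℕ r) ] %ℕ r ≡ a
    reduces-a = %ℕ-residue r a<r (mod-trans (α-cong-mod γ₀≡γ) (mod-sym a≡α[γ]))
    reduces-b : β[ + (γ %ℕ r) ] %ℕ r ≡ b
    reduces-b = %ℕ-residue r b<r (mod-trans (β-cong-mod γ₀≡γ) (mod-sym b≡β[γ]))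

module FromInteger {c ℓ : Level} (R : CommutativeRing c ℓ) where
  open CommutativeRing R hiding (refl; sym; trans)
  open CommutativeRing R using () renaming (refl to ≈-refl; sym to ≈-sym; trans to ≈-trans)
  open InRing R using (fromℕ; fromℤ)
  open import Algebra.Definitions.RawMonoid +-rawMonoid using () renaming (_×_ to _×ᴿ_)
  open import Algebra.Properties.Semiring.Mult semiring using (×1-homo-*)
  open import Algebra.Properties.Ring ring using (-‿distribˡ-*; -‿distribʳ-*; -‿involutive; -0#≈0#)
  open import Data.Sign as Sign using (Sign)
  open import Relation.Binary.Reasoning.Setoid setoid

  fromℕ≡×1 : ∀ n → fromℕ n ≡ n ×ᴿ 1#
  fromℕ≡×1 zero    = refl
  fromℕ≡×1 (suc n) = cong (_+_ 1#) (fromℕ≡×1 n)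

  fromℕ-* : ∀ m n → fromℕ (m ℕ.* n) ≈ fromℕ m * fromℕ n
  fromℕ-* m n = begin
    fromℕ (m ℕ.* n)           ≡⟨ fromℕ≡×1 (m ℕ.* n) ⟩
    (m ℕ.* n) ×ᴿ 1#           ≈⟨ ×1-homo-* m n ⟩
    (m ×ᴿ 1#) * (n ×ᴿ 1#)     ≡⟨ cong₂ _*_ (fromℕ≡×1 m) (fromℕ≡×1 n) ⟨
    fromℕ m * fromℕ n         ∎

  signed : Sign → Carrier → Carrier
  signed Sign.+ x = x
  signed Sign.- x = - x

  signed-cong : ∀ s {x y} → x ≈ y → signed s x ≈ signed s y
  signed-cong Sign.+ x≈y = x≈y
  signed-cong Sign.- x≈y = -‿cong x≈y

  signed-* : ∀ s t x y → signed (s Sign.* t) (x * y) ≈ signed s x * signed t y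
  signed-* Sign.+ Sign.+ x y = ≈-refl
  signed-* Sign.+ Sign.- x y = -‿distribʳ-* x y
  signed-* Sign.- Sign.+ x y = -‿distribˡ-* x y
  signed-* Sign.- Sign.- x y = ≈-trans (≈-sym (-‿involutive (x * y)))
                                       (≈-trans (-‿cong (-‿distribʳ-* x y)) (-‿distribˡ-* x (- y)))

  fromℤ-◃ : ∀ s n → fromℤ (s ℤ.◃ n) ≈ signed s (fromℕ n)
  fromℤ-◃ Sign.+ zero    = ≈-refl
  fromℤ-◃ Sign.- zero    = ≈-sym -0#≈0#
  fromℤ-◃ Sign.+ (suc n) = ≈-refl
  fromℤ-◃ Sign.- (suc n) = ≈-refl

  fromℤ-signed : ∀ i → fromℤ i ≡ signed (ℤ.sign i) (fromℕ ℤ.∣ i ∣)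
  fromℤ-signed (+ zero)    = refl
  fromℤ-signed (+ suc n)   = refl
  fromℤ-signed ℤ.-[1+ n ]  = refl

  fromℤ-* : ∀ i j → fromℤ (i ℤ.* j) ≈ fromℤ i * fromℤ j
  fromℤ-* i j = begin
    fromℤ (i ℤ.* j)                                  ≈⟨ fromℤ-◃ (s Sign.* t) (m ℕ.* n) ⟩
    signed (s Sign.* t) (fromℕ (m ℕ.* n))            ≈⟨ signed-cong (s Sign.* t) (fromℕ-* m n) ⟩
    signed (s Sign.* t) (fromℕ m * fromℕ n)          ≈⟨ signed-* s t (fromℕ m) (fromℕ n) ⟩
    signed s (fromℕ m) * signed t (fromℕ n)          ≡⟨ cong₂ _*_ (fromℤ-signed i) (fromℤ-signed j) ⟨
    fromℤ i * fromℤ j                                ∎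
    where
    s = ℤ.sign i
    t = ℤ.sign j
    m = ℤ.∣ i ∣
    n = ℤ.∣ j ∣

module _ {c ℓ : Level} (R : CommutativeRing c ℓ) (ζ : CommutativeRing.Carrier R) where
  open CommutativeRing R hiding (refl; sym; trans)
  open CommutativeRing R using () renaming (trans to ≈-trans)
  open InRing R
  open ListSum R
  open FromInteger R
  open import Data.List using (upTo)
  import Data.List.Relation.Unary.Unique.Propositional.Properties as Unique
  open import Relation.Binary.Reasoning.Setoid setoid

  ee-cong : ∀ {r} .{{_ : NonZero r}} {a b} → a ≡ b mod r → ee ζ r a ≡ ee ζ r b
  ee-cong {r} a≡b = cong (pow ζ) (≡-mod⇒%ℕ≡ r a≡b)

  module _ (r : ℕ) .{{_ : NonZero r}} (h k : ℤ) where

    summand : ℕ × ℕ → Carrier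
    summand ab = fromℤ (sqrtLambda r (+ proj₁ ab) (+ proj₂ ab)) * ee ζ r (+ proj₁ ab ℤ.* h ℤ.+ + proj₂ ab ℤ.* k)

    rhs-summand : ℕ → Carrier
    rhs-summand g = fromℤ (jacobi (+ g) r) * ee ζ r (α[ + g ] ℤ.* h ℤ.+ β[ + g ] ℤ.* k)

    lhs≈rhs-3∣r : Squarefree r → 3 ℕD.∣ r → lhs ζ r h k ≈ rhs ζ r h k
    lhs≈rhs-3∣r r-squarefree 3∣r = begin
      sumL (discPairs r) summand     ≈⟨ sumL-0 (discPairs r) vanishes ⟩
      0#                             ≈⟨ zeroˡ _ ⟨
      0# * sumL (upTo r) rhs-summand ≡⟨ cong (λ j → fromℤ j * sumL (upTo r) rhs-summand) (jacobi-3≡0 r-squarefree 3∣r) ⟨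
      rhs ζ r h k                    ∎
      where
      vanishes : ∀ {ab} → ab ∈ discPairs r → summand ab ≈ 0#
      vanishes {a , b} ab∈ = ≈-trans (*-congʳ (reflexive (cong fromℤ (sqrtLambda-3≡0 (+ b) r-squarefree 3∣r 3∣a)))) (zeroˡ _)
        where
        3∣a = 3∣discriminant⇒3∣α (+ a) (+ b) (ℤD.∣-trans (∣ᵤ⇒∣ 3∣r) (proj₂ (proj₂ (∈-discPairs⁻ r ab∈))))

    lhs≈rhs-3∤r : Squarefree r → Odd r → ¬ 3 ℕD.∣ r → lhs ζ r h k ≈ rhs ζ r h k
    lhs≈rhs-3∤r r-squarefree r-odd 3∤r = begin
      sumL (discPairs r) summand
        ≈⟨ sumL-reindex param summand (Unique.upTo⁺ r) (discPairs-unique r) param-injective (λ {g} _ → param-∈ g) param-onto ⟩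
      sumL (upTo r) (λ g → summand (param g))
        ≈⟨ sumL-cong (upTo r) (λ {g} _ → summand-param g) ⟩
      sumL (upTo r) (λ g → fromℤ (jacobi (+ 3) r) * rhs-summand g)
        ≈⟨ *-distribˡ-sumL (upTo r) (fromℤ (jacobi (+ 3) r)) rhs-summand ⟨
      rhs ζ r h k
        ∎
      where
      open Parametrisation r-squarefree r-odd 3∤r
      summand-param : ∀ g → summand (param g) ≈ fromℤ (jacobi (+ 3) r) * rhs-summand g
      summand-param g = begin
        fromℤ (sqrtLambda r (+ α₀) (+ β₀)) * ee ζ r (+ α₀ ℤ.* h ℤ.+ + β₀ ℤ.* k)
          ≡⟨ cong₂ _*_ (cong fromℤ (sqrtLambda-singular (+ g) r-squarefree r-odd α₀≡ β₀≡))
                       (ee-cong (+-cong-mod (*-cong-mod α₀≡ mod-refl) (*-cong-mod β₀≡ mod-refl))) ⟩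
        fromℤ (jacobi (+ 3) r ℤ.* jacobi (+ g) r) * ee ζ r (α[ + g ] ℤ.* h ℤ.+ β[ + g ] ℤ.* k)
          ≈⟨ *-congʳ (fromℤ-* (jacobi (+ 3) r) (jacobi (+ g) r)) ⟩
        fromℤ (jacobi (+ 3) r) * fromℤ (jacobi (+ g) r) * ee ζ r (α[ + g ] ℤ.* h ℤ.+ β[ + g ] ℤ.* k)
          ≈⟨ *-assoc _ _ _ ⟩
        fromℤ (jacobi (+ 3) r) * rhs-summand g
          ∎
        where
        α₀ = α[ + g ] %ℕ r
        β₀ = β[ + g ] %ℕ r
        α₀≡ = %ℕ-≡-mod r α[ + g ]
        β₀≡ = %ℕ-≡-mod r β[ + g ]

  lhs≈rhs : ∀ r .{{_ : NonZero r}} → Odd r → Squarefree r → ∀ h k → lhs ζ r h k ≈ rhs ζ r h k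
  lhs≈rhs r r-odd r-squarefree h k with 3 ℕD.∣? r
  ... | yes 3∣r = lhs≈rhs-3∣r r h k r-squarefree 3∣r
  ... | no 3∤r  = lhs≈rhs-3∤r r h k r-squarefree r-odd 3∤r

-- The identity holds term by term after reindexing.
lemma4p8 : ∀ {c ℓ : Level} (R : CommutativeRing c ℓ) → InRing.IntegralDomain R →
           ∀ (ζ : CommutativeRing.Carrier R) (r : ℕ) .{{_ : NonZero r}} →
           InRing.PrimitiveRoot R r ζ → Odd r → Squarefree r →
           ∀ (h k : ℤ) →
           CommutativeRing._≈_ R (InRing.lhs R ζ r h k) (InRing.rhs R ζ r h k)
lemma4p8 R _ ζ r _ r-odd r-squarefree h k = lhs≈rhs R ζ r r-odd r-squarefree h k
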